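{- In the setting described in the context, with $v\in\mathbf{V}_i$, $\mu=\Phi(\tau)$ and $\mu'=\Phi(\tau^{\gamma})$: $\deg(\mu'_{\mathbf{X}_0\cup\mathbf{X}_i})\le\deg(\mu_{\mathbf{X}_0\cup\mathbf{X}_i})$. Furthermore, there is a divisor $\nu$ of $\mu_{\mathbf{X}_0\cup\mathbf{X}_i}$ with $\deg\nu=\deg(\mu'_{\mathbf{X}_0\cup\mathbf{X}_i})$ such that $\mu'_{\mathbf{X}_0\cup\mathbf{X}_i}\succeq\nu$.
   Context: Let $\mathbf{V}=\mathbf{V}_1\cup\cdots\cup\mathbf{V}_m$ (pairwise disjoint finite sets), $\mathbf{a}=(a_1,\ldots,a_m)$ nonnegative integers with $a_i\le|\mathbf{V}_i|$, $1\le d\le\sum_i a_i$. $\Lambda$: simplicial complex on $\mathbf{V}$ with faces the $\tau\subseteq\mathbf{V}$ such that $|\tau\cap\mathbf{V}_i|\le a_i$ for all $i$ and $|\tau|\le d$; facets = faces of size $d$. Order $\mathbf{V}$ by $\succ$ with all of $\mathbf{V}_i$ before $\mathbf{V}_j$ for $i<j$; write $\mathbf{V}_i=\{v^i_1\succ v^i_2\succ\cdots\}$. Revlex on equal-size sets: $S\succ T$ if the $\succ$-least element of the symmetric difference lies in $T$. $\mathcal{R}_{\mathrm{Lex}}(\tau)=\{u\in\tau:\tau-\{u\}\subseteq\tau'\text{ for some facet }\tau'\succ\tau\}$. For a facet $\tau$: $\mathrm{FL}(\tau)=\{i:|\tau\cap\mathbf{V}_i|=a_i\}$; $\mathrm{Gap}(\tau)$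 is the $\succ$-largest element of $\mathbf{V}$ lying neither in $\tau$ nor in any $\mathbf{V}_i$ with $i\in\mathrm{FL}(\tau)$, if one exists; $\mathrm{tail}(\tau)=\{u\in\tau:u\prec\mathrm{Gap}(\tau)\}$ (empty if no Gap); for $i\in\mathrm{FL}(\tau)$ with $\mathbf{V}_i\not\subseteq\tau$, $\mathrm{fgap}(\tau,i)$ is the $\succ$-largest element of $\mathbf{V}_i-\tau$; $\mathrm{up}(\tau)=\{u\in\tau\cap\mathbf{V}_i:i\in\mathrm{FL}(\tau),\ \mathbf{V}_i\not\subseteq\tau,\ u\prec\mathrm{fgap}(\tau,i)\}$. One has $\mathcal{R}_{\mathrm{Lex}}(\tau)=\mathrm{up}(\tau)\cup\mathrm{tail}(\tau)$. Let $\tau$ be a facet and $\gamma$ a set with $\mathcal{R}_{\mathrm{Lex}}(\tau)\not\subseteq\gamma\subset\tau$; choose $v\in\mathcal{R}_{\mathrm{Lex}}(\tau)-\gamma$. If $v\in\mathrm{tail}(\tau)$ let $w=\mathrm{Gap}(\tau)$; otherwise $v\in\mathrm{up}(\tau)$ and $w=\mathrm{fgap}(\tau,i)$ with $v\in\mathbf{V}_i$. Set $\tau^{\gamma}=(\tau-\{v\})\cup\{w\}$ (a facet of $\Lambda$). $\Phi$: variables $\mathbf{X}_i=\{x^i_1\succ\cdots\succ x^i_{|\mathbf{V}_i|-a_i}\}$ ($1\le i\le m$), $\mathbf{X}_0=\{x^0_1\succ\cdots\succ x^0_c\}$, $c=(\sum a_i)-d$, with all of $\mathbf{X}_i$ $\succ$-before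 $\mathbf{X}_j$ for $i<j$; $\mu_Y$ = part of $\mu$ supported in $Y$; revlex on monomials of equal degree: $\mu_1\succ\mu_2$ if the $\succ$-least variable of $\mu_1/\mu_2$ has negative exponent. For totally ordered $V=\{v_1\succ\cdots\succ v_N\}$, $0\le a\le N$, $X=\{x_1\succ\cdots\succ x_{N-a}\}$, $\phi(V,X)$ sends an $a$-subset $\{v_1,\ldots,v_t,v_{i_1},\ldots,v_{i_s}\}$ ($t+s=a$, $t+1<i_1<\cdots<i_s$) to $x_{i_1-(t+1)}\cdots x_{i_s-(t+s)}$. For a facet $\tau$, $\mathrm{fill}_i(\tau)$ = revlex-first $a_i$-subset of $\mathbf{V}_i$ containing $\tau\cap\mathbf{V}_i$; $\Phi_i(\tau)=\phi(\mathbf{V}_i,\mathbf{X}_i)(\mathrm{fill}_i(\tau))$; $\mathbf{V}[\tau]$ = the $\succ$-first $a_i-\deg\Phi_i(\tau)$ elements of each $\mathbf{V}_i$; $\Phi_0(\tau)=\phi(\mathbf{V}[\tau],\mathbf{X}_0)(\tau\cap\mathbf{V}[\tau])$; $\Phi(\tau)=\prod_{i=0}^m\Phi_i(\tau)$. -}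

module Defs where

open import Data.Nat using (ℕ; zero; suc; _+_; _∸_; _≤_; _<_; _≡ᵇ_; _<ᵇ_)
open import Data.Nat.Properties using ()
open import Data.Bool using (Bool; true; false; if_then_else_)
open import Data.Fin using (Fin; toℕ)
open import Data.Fin.Properties using () renaming (_≟_ to _≟F_)
open import Data.Nat.ListAction using (sum)
open import Data.List using (List; []; _∷_; map; drop; take; length; concatMap; upTo; reverse; _++_; allFin)
open import Data.Product using (Σ; ∃; _×_; _,_; proj₁; proj₂)
open import Data.Product.Properties using (≡-dec)
open import Data.Sum using (_⊎_)
open import Relation.Nullary using (¬_; does)
open import Relation.Binary.PropositionalEquality using (_≡_; _≢_)

cntB : List Bool → ℕ
cntB [] = 0
cntB (true ∷ bs) = suc (cntB bs)
cntB (false ∷ bs) = cntB bs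

cntEq : ℕ → List ℕ → ℕ
cntEq r [] = 0
cntEq r (x ∷ xs) = if r ≡ᵇ x then suc (cntEq r xs) else cntEq r xs

-- A totally ordered V = {v_1 ≻ ... ≻ v_N} and a subset A of V are
-- encoded as the list of booleans [v_1 ∈ A, ..., v_N ∈ A].
-- A monomial in X = {x_1 ≻ ... ≻ x_L} is encoded as its exponent list
-- [e_1, ..., e_L] (e_r = exponent of x_r), listed in ≻-order.

leadT : List Bool → ℕ
leadT [] = 0
leadT (true ∷ bs) = suc (leadT bs)
leadT (false ∷ bs) = 0

-- 1-based positions of the `true` entries of a list whose first entry
-- has position (p+1)
truePos : ℕ → List Bool → List ℕ
truePos p [] = []
truePos p (true ∷ bs) = suc p ∷ truePos (suc p) bs
truePos p (false ∷ bs) = truePos (suc p) bs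

subIdx : ℕ → ℕ → List ℕ → List ℕ
subIdx t k [] = []
subIdx t k (i ∷ is) = (i ∸ (t + k)) ∷ subIdx t (suc k) is

-- indices of the variables of φ(A) = x_{i_1-(t+1)} ⋯ x_{i_s-(t+s)}
-- (with multiplicity), where i_1 < ... < i_s are the positions of the
-- elements of A other than v_1..v_t
phiIdx : List Bool → List ℕ
phiIdx bs = subIdx (leadT bs) 1 (truePos (leadT bs) (drop (leadT bs) bs))

-- φ(V,X)(A) as exponent list over x_1,...,x_L  (L = |X| = N - a)
phiMon : ℕ → List Bool → List ℕ
phiMon L bs = map (λ r → cntEq (suc r) (phiIdx bs)) (upTo L)

deg : List ℕ → ℕ
deg = sum

data Divides : List ℕ → List ℕ → Set where
  []  : Divides [] []
  _∷_ : ∀ {x y xs ys} → x ≤ y → Divides xs ys → Divides (x ∷ xs) (y ∷ ys)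

-- Revlex on monomials: μ₁ ≻ μ₂ iff the ≻-least variable occurring in
-- μ₁/μ₂ has negative exponent.  Variables are listed in ≻-order, so we
-- compare the reversed exponent lists at their first difference.
data FirstDiffLt : List ℕ → List ℕ → Set where
  here  : ∀ {x y xs ys} → x < y → length xs ≡ length ys →
          FirstDiffLt (x ∷ xs) (y ∷ ys)
  there : ∀ {x xs ys} → FirstDiffLt xs ys → FirstDiffLt (x ∷ xs) (x ∷ ys)

_≻ᵐ_ : List ℕ → List ℕ → Set
μ₁ ≻ᵐ μ₂ = FirstDiffLt (reverse μ₁) (reverse μ₂)

_⪰ᵐ_ : List ℕ → List ℕ → Set
μ₁ ⪰ᵐ μ₂ = (μ₁ ≡ μ₂) ⊎ (μ₁ ≻ᵐ μ₂)

-- Revlex on (equal-size) subsets of a type ordered by a rank function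
-- rk (smaller rank = ≻-larger): S ≻ T iff the ≻-least element of the
-- symmetric difference lies in T.
RevGtSet : {A : Set} → (A → ℕ) → (A → Bool) → (A → Bool) → Set
RevGtSet {A} rk S T =
  Σ A λ u → T u ≡ true × S u ≡ false ×
    (∀ x → S x ≢ T x → rk x ≤ rk u)

-- The setting: m blocks, |V_k| = n k, bounds a k, facet size d.

Σa : (m : ℕ) → (Fin m → ℕ) → ℕ
Σa m a = sum (map a (allFin m))

module Setup (m : ℕ) (n a : Fin m → ℕ) (d : ℕ) where

  -- element v^k_{j+1} of V_k is (k , j)
  El : Set
  El = Σ (Fin m) (λ k → Fin (n k))

  _≟El_ : (u v : El) → Relation.Nullary.Dec (u ≡ v)
  _≟El_ = ≡-dec _≟F_ _≟F_

  -- position in the total order ≻ (smaller position = ≻-larger)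
  offset : Fin m → ℕ
  offset i = sum (map (λ k → if toℕ k <ᵇ toℕ i then n k else 0) (allFin m))

  pos : El → ℕ
  pos (k , j) = offset k + toℕ j

  Sub : Set
  Sub = (k : Fin m) → Fin (n k) → Bool

  _∈ₛ_ : El → Sub → Set
  u ∈ₛ S = S (proj₁ u) (proj₂ u) ≡ true

  _∉ₛ_ : El → Sub → Set
  u ∉ₛ S = ¬ (u ∈ₛ S)

  _⊆ₛ_ : Sub → Sub → Set
  S ⊆ₛ T = ∀ u → u ∈ₛ S → u ∈ₛ T

  _⊂ₛ_ : Sub → Sub → Set
  S ⊂ₛ T = S ⊆ₛ T × Σ El (λ u → u ∈ₛ T × u ∉ₛ S)

  asPred : Sub → El → Bool
  asPred S u = S (proj₁ u) (proj₂ u)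

  row : Sub → (k : Fin m) → List Bool
  row S k = map (S k) (allFin (n k))

  cnt : Sub → Fin m → ℕ
  cnt S k = cntB (row S k)

  size : Sub → ℕ
  size S = sum (map (cnt S) (allFin m))

  Facet : Sub → Set
  Facet τ = (∀ k → cnt τ k ≤ a k) × size τ ≡ d

  _≻ₛ_ : Sub → Sub → Set
  S ≻ₛ T = RevGtSet pos (asPred S) (asPred T)

  RLex : Sub → El → Set
  RLex τ u = u ∈ₛ τ × Σ Sub (λ τ' → Facet τ' × τ' ≻ₛ τ ×
               (∀ x → x ∈ₛ τ → x ≢ u → x ∈ₛ τ'))

  FL : Sub → Fin m → Set
  FL τ k = cnt τ k ≡ a k

  IsGap : Sub → El → Set
  IsGap τ w = w ∉ₛ τ × ¬ FL τ (proj₁ w) ×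
              (∀ x → x ∉ₛ τ → ¬ FL τ (proj₁ x) → pos w ≤ pos x)

  Tail : Sub → El → Set
  Tail τ u = u ∈ₛ τ × Σ El (λ g → IsGap τ g × pos g < pos u)

  IsFgap : Sub → Fin m → El → Set
  IsFgap τ i w = proj₁ w ≡ i × FL τ i × w ∉ₛ τ ×
                 (∀ x → proj₁ x ≡ i → x ∉ₛ τ → pos w ≤ pos x)

  exchange : Sub → El → El → Sub
  exchange τ v w k j with (k , j) ≟El w | (k , j) ≟El v
  ... | Relation.Nullary.yes _ | _ = true
  ... | Relation.Nullary.no _ | Relation.Nullary.yes _ = false
  ... | Relation.Nullary.no _ | Relation.Nullary.no _ = τ k j

  -- a choice of one a_k-subset of V_k for every block k
  Fill : Set
  Fill = Sub

  IsFillBlock : Sub → (k : Fin m) → (Fin (n k) → Bool) → Set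
  IsFillBlock τ k F = cntB (map F (allFin (n k))) ≡ a k ×
    (∀ j → τ k j ≡ true → F j ≡ true) ×
    (∀ (G : Fin (n k) → Bool) → cntB (map G (allFin (n k))) ≡ a k →
       (∀ j → τ k j ≡ true → G j ≡ true) →
       Σ (Fin (n k)) (λ j → G j ≢ F j) → RevGtSet toℕ F G)

  IsFill : Sub → Fill → Set
  IsFill τ F = ∀ k → IsFillBlock τ k (F k)

  Φk : Fill → Fin m → List ℕ
  Φk F k = phiMon (n k ∸ a k) (row F k)

  c : ℕ
  c = Σa m a ∸ d

  trimmed : Sub → Fill → List Bool
  trimmed τ F = concatMap (λ k → take (a k ∸ deg (Φk F k)) (row τ k)) (allFin m)

  Φ0 : Sub → Fill → List ℕ
  Φ0 τ F = phiMon c (trimmed τ F)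

  μRestr : Sub → Fill → Fin m → List ℕ
  μRestr τ F i = Φ0 τ F ++ Φk F i

-- Write μ for the exponent vector of μ_{X_0 ∪ X_i}, variables listed in ≻-order.  If each
-- suffix of μ′ (the exponents of the variables ≻-below some point) has degree at most the
-- corresponding suffix of μ, then taking exponents from μ greedily, starting from the
-- ≻-smallest variable, gives the divisor ν.  Suffix degrees of φ are counts: an element of A
-- contributes the variable indexed by its depth, the number of non-elements of A before it,
-- so the degree of φ(A) in x_{r+1}, x_{r+2}, … is the number of elements of depth > r.
-- The exchange τ ↦ τ^γ moves one element of τ to an earlier position: inside V_i (v ∈ up(τ),
-- or Gap(τ) ∈ V_i) or into a non-full earlier block (v ∈ tail(τ)).  Moving an element earlier
-- never increases depths; fill_i fills the earliest non-members, and V[τ] ∩ V_i is the part of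
-- V_i before the first non-member of fill_i(τ).  So the suffix degrees in X_i can only drop,
-- and those in X_0 ∪ X_i drop once the change of deg Φ_i is accounted for.
module Submission where

open import Data.Nat using (ℕ; zero; suc; _+_; _∸_; _≤_; _<_; z≤n; s≤s; _≡ᵇ_; _<ᵇ_; pred; _⊓_)
open import Data.Nat.Properties
open import Data.Nat.Solver using (module +-*-Solver)
open import Data.Nat.ListAction using (sum)
open import Data.Nat.ListAction.Properties using (sum-++)
open import Data.Bool using (Bool; true; false; if_then_else_)
import Data.Bool.Properties as Bool
open import Data.Fin using (Fin; toℕ) renaming (zero to fzero; suc to fsuc)
open import Data.Fin.Properties using (toℕ-injective; any?) renaming (_≟_ to _≟F_)
import Data.Fin.Properties as Fin
open import Data.List using (List; []; _∷_; map; drop; take; length; concatMap; upTo; reverse; _++_; allFin; tabulate)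
open import Data.List.Properties using (++-assoc; ++-identityʳ; map-tabulate; tabulate-cong; map-cong; map-++; concatMap-++; concatMap-cong; length-++; length-map; length-tabulate; length-applyUpTo; unfold-reverse; drop-map; map-upTo)
open import Data.List.Relation.Unary.All using (All; []; _∷_)
import Data.List.Relation.Unary.All as All
open import Data.List.Relation.Unary.All.Properties using (tabulate⁺; map⁺)
open import Data.Product using (Σ; _×_; _,_; proj₁; proj₂)
open import Data.Sum using (_⊎_; inj₁; inj₂)
import Data.Sum as Sum
open import Data.Empty using (⊥-elim)
open import Function using (_∘_; id)
open import Function.Bundles using (Equivalence)
open import Relation.Nullary using (¬_; Dec; yes; no; ¬?; _×-dec_; contradiction)
open import Relation.Nullary.Decidable using (decidable-stable)
open import Relation.Binary.Definitions using (tri<; tri≈; tri>)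
open import Relation.Binary.PropositionalEquality using (_≡_; _≢_; refl; sym; trans; cong; cong₂; subst; subst₂; module ≡-Reasoning)
open import Algebra.Properties.CommutativeSemigroup +-commutativeSemigroup using (interchange)
open +-*-Solver using (solve; _:+_; _:=_; con)

open import Defs

<ᵇ-true : ∀ {x y} → x < y → (x <ᵇ y) ≡ true
<ᵇ-true x<y = Equivalence.to Bool.T-≡ (<⇒<ᵇ x<y)

<ᵇ-sound : ∀ x y → (x <ᵇ y) ≡ true → x < y
<ᵇ-sound x y eq = <ᵇ⇒< x y (Equivalence.from Bool.T-≡ eq)

<ᵇ-irrefl : ∀ x → (x <ᵇ x) ≡ false
<ᵇ-irrefl x = Bool.¬-not (λ eq → <-irrefl refl (<ᵇ-sound x x eq))

∸-≡-suc : ∀ x y → y < x → x ∸ y ≡ suc (x ∸ suc y)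
∸-≡-suc (suc x) zero (s≤s p) = refl
∸-≡-suc (suc x) (suc y) (s≤s p) = ∸-≡-suc x y p

bit : Bool → ℕ
bit true = 1
bit false = 0

falses : List Bool → ℕ
falses [] = 0
falses (true ∷ bs) = falses bs
falses (false ∷ bs) = suc (falses bs)

falses-++ : ∀ A B → falses (A ++ B) ≡ falses A + falses B
falses-++ [] B = refl
falses-++ (true ∷ A) B = falses-++ A B
falses-++ (false ∷ A) B = cong suc (falses-++ A B)

cntB+falses : ∀ R → cntB R + falses R ≡ length R
cntB+falses [] = refl
cntB+falses (true ∷ R) = cong suc (cntB+falses R)
cntB+falses (false ∷ R) = trans (+-suc (cntB R) (falses R)) (cong suc (cntB+falses R))

ltBit : ℕ → ℕ → ℕ
ltBit r zero = 0
ltBit zero (suc g) = 1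
ltBit (suc r) (suc g) = ltBit r g

ltBit-≤1 : ∀ r g → ltBit r g ≤ 1
ltBit-≤1 r zero = z≤n
ltBit-≤1 zero (suc g) = ≤-refl
ltBit-≤1 (suc r) (suc g) = ltBit-≤1 r g

ltBit-mono : ∀ r {g h} → g ≤ h → ltBit r g ≤ ltBit r h
ltBit-mono r {zero} z≤n = z≤n
ltBit-mono zero {suc g} {suc h} (s≤s p) = ≤-refl
ltBit-mono (suc r) {suc g} {suc h} (s≤s p) = ltBit-mono r p

ltBit-suc : ∀ r g → ltBit r g ≤ ltBit r (suc g)
ltBit-suc r g = ltBit-mono r (n≤1+n g)

-- The depth of an entry of a row is the number of false entries before it,
-- plus an initial offset g.  deepTrues g bs r counts the true entries of depth > r.
deepTrues : ℕ → List Bool → ℕ → ℕ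
deepTrues g [] r = 0
deepTrues g (true ∷ bs) r = ltBit r g + deepTrues g bs r
deepTrues g (false ∷ bs) r = deepTrues (suc g) bs r

deepTrues-mono : ∀ {g h} bs r → g ≤ h → deepTrues g bs r ≤ deepTrues h bs r
deepTrues-mono [] r p = z≤n
deepTrues-mono (true ∷ bs) r p = +-mono-≤ (ltBit-mono r p) (deepTrues-mono bs r p)
deepTrues-mono (false ∷ bs) r p = deepTrues-mono bs r (s≤s p)

deepTrues-≤-length : ∀ g bs r → deepTrues g bs r ≤ length bs
deepTrues-≤-length g [] r = z≤n
deepTrues-≤-length g (true ∷ bs) r = +-mono-≤ (ltBit-≤1 r g) (deepTrues-≤-length g bs r)
deepTrues-≤-length g (false ∷ bs) r = m≤n⇒m≤1+n (deepTrues-≤-length (suc g) bs r)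

deepTrues-++ : ∀ g A B r → deepTrues g (A ++ B) r ≡ deepTrues g A r + deepTrues (g + falses A) B r
deepTrues-++ g [] B r = cong (λ h → deepTrues h B r) (sym (+-identityʳ g))
deepTrues-++ g (true ∷ A) B r =
  trans (cong (ltBit r g +_) (deepTrues-++ g A B r)) (sym (+-assoc (ltBit r g) _ _))
deepTrues-++ g (false ∷ A) B r =
  trans (deepTrues-++ (suc g) A B r) (cong (λ h → deepTrues (suc g) A r + deepTrues h B r) (sym (+-suc g (falses A))))

deepTrues-suc-zero : ∀ g bs → deepTrues (suc g) bs 0 ≡ cntB bs
deepTrues-suc-zero g [] = refl
deepTrues-suc-zero g (true ∷ bs) = cong suc (deepTrues-suc-zero g bs)
deepTrues-suc-zero g (false ∷ bs) = deepTrues-suc-zero (suc g) bs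

deepTrues-zero+leadT : ∀ bs → deepTrues 0 bs 0 + leadT bs ≡ cntB bs
deepTrues-zero+leadT [] = refl
deepTrues-zero+leadT (true ∷ bs) = trans (+-suc _ (leadT bs)) (cong suc (deepTrues-zero+leadT bs))
deepTrues-zero+leadT (false ∷ bs) = trans (+-identityʳ _) (deepTrues-suc-zero 0 bs)

-- Exchanging a true with a later false lowers the depth of that true.
deepTrues-advanceTrue-head : ∀ g Y Z r →
  ltBit r g + deepTrues g (Y ++ false ∷ Z) r ≤ deepTrues (suc g) (Y ++ true ∷ Z) r
deepTrues-advanceTrue-head g [] Z r = +-monoˡ-≤ (deepTrues (suc g) Z r) (ltBit-suc r g)
deepTrues-advanceTrue-head g (true ∷ Y) Z r = begin
  ltBit r g + (ltBit r g + deepTrues g (Y ++ false ∷ Z) r)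
    ≤⟨ +-mono-≤ (ltBit-suc r g) (deepTrues-advanceTrue-head g Y Z r) ⟩
  ltBit r (suc g) + deepTrues (suc g) (Y ++ true ∷ Z) r ∎
  where open ≤-Reasoning
deepTrues-advanceTrue-head g (false ∷ Y) Z r =
  ≤-trans (+-monoˡ-≤ _ (ltBit-suc r g)) (deepTrues-advanceTrue-head (suc g) Y Z r)

deepTrues-advanceTrue : ∀ g X Y Z r →
  deepTrues g (X ++ true ∷ Y ++ false ∷ Z) r ≤ deepTrues g (X ++ false ∷ Y ++ true ∷ Z) r
deepTrues-advanceTrue g [] Y Z r = deepTrues-advanceTrue-head g Y Z r
deepTrues-advanceTrue g (true ∷ X) Y Z r = +-monoʳ-≤ (ltBit r g) (deepTrues-advanceTrue g X Y Z r)
deepTrues-advanceTrue g (false ∷ X) Y Z r = deepTrues-advanceTrue (suc g) X Y Z r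

deepTrues-trues-++ : ∀ h E Z r → falses E ≡ 0 → deepTrues h (E ++ Z) r ≤ length E + deepTrues h Z r
deepTrues-trues-++ h [] Z r e = ≤-refl
deepTrues-trues-++ h (true ∷ E) Z r e =
  +-mono-≤ (ltBit-≤1 r h) (deepTrues-trues-++ h E Z r e)

deepTrues-advanceTrue-dropTrues-head : ∀ g Y E Z r → falses E ≡ 0 →
  ltBit r g + deepTrues g (Y ++ false ∷ E ++ Z) r ≤ deepTrues (suc g) (Y ++ Z) r + suc (length E)
deepTrues-advanceTrue-dropTrues-head g [] E Z r fe = begin
  ltBit r g + deepTrues (suc g) (E ++ Z) r
    ≤⟨ +-mono-≤ (ltBit-≤1 r g) (deepTrues-trues-++ (suc g) E Z r fe) ⟩
  1 + (length E + deepTrues (suc g) Z r) ≡⟨ cong suc (+-comm (length E) _) ⟩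
  suc (deepTrues (suc g) Z r + length E) ≡⟨ sym (+-suc _ _) ⟩
  deepTrues (suc g) Z r + suc (length E) ∎
  where open ≤-Reasoning
deepTrues-advanceTrue-dropTrues-head g (true ∷ Y) E Z r fe = begin
  ltBit r g + (ltBit r g + deepTrues g (Y ++ false ∷ E ++ Z) r)
    ≤⟨ +-mono-≤ (ltBit-suc r g) (deepTrues-advanceTrue-dropTrues-head g Y E Z r fe) ⟩
  ltBit r (suc g) + (deepTrues (suc g) (Y ++ Z) r + suc (length E))
    ≡⟨ sym (+-assoc (ltBit r (suc g)) _ _) ⟩
  ltBit r (suc g) + deepTrues (suc g) (Y ++ Z) r + suc (length E) ∎
  where open ≤-Reasoning
deepTrues-advanceTrue-dropTrues-head g (false ∷ Y) E Z r fe =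
  ≤-trans (+-monoˡ-≤ _ (ltBit-suc r g)) (deepTrues-advanceTrue-dropTrues-head (suc g) Y E Z r fe)

deepTrues-advanceTrue-dropTrues : ∀ g X Y E Z r → falses E ≡ 0 →
  deepTrues g (X ++ true ∷ Y ++ false ∷ E ++ Z) r ≤ deepTrues g (X ++ false ∷ Y ++ Z) r + suc (length E)
deepTrues-advanceTrue-dropTrues g [] Y E Z r fe = deepTrues-advanceTrue-dropTrues-head g Y E Z r fe
deepTrues-advanceTrue-dropTrues g (true ∷ X) Y E Z r fe = begin
  ltBit r g + deepTrues g (X ++ true ∷ Y ++ false ∷ E ++ Z) r
    ≤⟨ +-monoʳ-≤ (ltBit r g) (deepTrues-advanceTrue-dropTrues g X Y E Z r fe) ⟩
  ltBit r g + (deepTrues g (X ++ false ∷ Y ++ Z) r + suc (length E))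
    ≡⟨ sym (+-assoc (ltBit r g) _ _) ⟩
  ltBit r g + deepTrues g (X ++ false ∷ Y ++ Z) r + suc (length E) ∎
  where open ≤-Reasoning
deepTrues-advanceTrue-dropTrues g (false ∷ X) Y E Z r fe = deepTrues-advanceTrue-dropTrues (suc g) X Y E Z r fe

countAbove : ℕ → List ℕ → ℕ
countAbove r [] = 0
countAbove r (x ∷ xs) = ltBit r x + countAbove r xs

sum-map-+ : ∀ {X : Set} (f g : X → ℕ) (L : List X) →
  sum (map (λ x → f x + g x) L) ≡ sum (map f L) + sum (map g L)
sum-map-+ f g [] = refl
sum-map-+ f g (x ∷ L) =
  trans (cong (f x + g x +_) (sum-map-+ f g L)) (interchange (f x) (g x) (sum (map f L)) (sum (map g L)))

sum-map-++ : ∀ {X : Set} (f : X → ℕ) L₁ L₂ → sum (map f (L₁ ++ L₂)) ≡ sum (map f L₁) + sum (map f L₂)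
sum-map-++ f L₁ L₂ = trans (cong sum (map-++ f L₁ L₂)) (sum-++ (map f L₁) (map f L₂))

sum-map-mono : ∀ {X : Set} {f g : X → ℕ} (L : List X) → (∀ x → f x ≤ g x) → sum (map f L) ≤ sum (map g L)
sum-map-mono [] h = z≤n
sum-map-mono (x ∷ L) h = +-mono-≤ (h x) (sum-map-mono L h)

-- subIdx t k (truePos p bs) lists the depths of the true entries of bs,
-- when bs is preceded by g false entries and t + k - 1 true ones.
subIdx-invariant : ∀ g t k {p} → suc p ≡ g + t + k → suc p ∸ (t + k) ≡ g
subIdx-invariant g t k e = trans (cong (_∸ (t + k)) (trans e (+-assoc g t k))) (m+n∸n≡m g (t + k))

subIdx-invariant-suc : ∀ g t k {p} → suc p ≡ g + t + k → suc (suc p) ≡ g + t + suc k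
subIdx-invariant-suc g t k e = trans (cong suc e) (sym (+-suc (g + t) k))

subIdx-countAbove : ∀ r bs g t k p → suc p ≡ g + t + k →
  countAbove r (subIdx t k (truePos p bs)) ≡ deepTrues g bs r
subIdx-countAbove r [] g t k p e = refl
subIdx-countAbove r (true ∷ bs) g t k p e =
  cong₂ _+_ (cong (ltBit r) (subIdx-invariant g t k e)) (subIdx-countAbove r bs g t (suc k) (suc p) (subIdx-invariant-suc g t k e))
subIdx-countAbove r (false ∷ bs) g t k p e = subIdx-countAbove r bs (suc g) t k (suc p) (cong suc e)

subIdx-bounded : ∀ bs g t k p → suc p ≡ g + t + k → All (_≤ g + falses bs) (subIdx t k (truePos p bs))
subIdx-bounded [] g t k p e = []
subIdx-bounded (true ∷ bs) g t k p e =
  subst (_≤ g + falses bs) (sym (subIdx-invariant g t k e)) (m≤m+n g _) ∷ subIdx-bounded bs g t (suc k) (suc p) (subIdx-invariant-suc g t k e)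
subIdx-bounded (false ∷ bs) g t k p e =
  subst (λ z → All (_≤ z) (subIdx t k (truePos (suc p) bs))) (sym (+-suc g (falses bs)))
    (subIdx-bounded bs (suc g) t k (suc p) (cong suc e))

deepTrues-dropLead : ∀ bs r → deepTrues 0 (drop (leadT bs) bs) r ≡ deepTrues 0 bs r
deepTrues-dropLead [] r = refl
deepTrues-dropLead (true ∷ bs) r = deepTrues-dropLead bs r
deepTrues-dropLead (false ∷ bs) r = refl

falses-dropLead : ∀ bs → falses (drop (leadT bs) bs) ≡ falses bs
falses-dropLead [] = refl
falses-dropLead (true ∷ bs) = falses-dropLead bs
falses-dropLead (false ∷ bs) = refl

phiIdx-countAbove : ∀ r bs → countAbove r (phiIdx bs) ≡ deepTrues 0 bs r
phiIdx-countAbove r bs =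
  trans (subIdx-countAbove r (drop (leadT bs) bs) 0 (leadT bs) 1 (leadT bs) (+-comm 1 (leadT bs)))
        (deepTrues-dropLead bs r)

phiIdx-bounded : ∀ bs → All (_≤ falses bs) (phiIdx bs)
phiIdx-bounded bs = subst (λ z → All (_≤ z) (phiIdx bs)) (falses-dropLead bs)
  (subIdx-bounded (drop (leadT bs) bs) 0 (leadT bs) 1 (leadT bs) (+-comm 1 (leadT bs)))

map-upTo-suc : ∀ {A : Set} (f : ℕ → A) L → map f (upTo (suc L)) ≡ f 0 ∷ map (f ∘ suc) (upTo L)
map-upTo-suc f L = trans (map-upTo f (suc L)) (cong (f 0 ∷_) (sym (map-upTo (f ∘ suc) L)))

sum-drop-zeros : ∀ r (U : List ℕ) → sum (drop r (map (λ _ → 0) U)) ≡ 0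
sum-drop-zeros zero [] = refl
sum-drop-zeros zero (x ∷ U) = sum-drop-zeros zero U
sum-drop-zeros (suc r) [] = refl
sum-drop-zeros (suc r) (x ∷ U) = sum-drop-zeros r U

sum-drop-map-+ : ∀ r (U : List ℕ) (f g : ℕ → ℕ) →
  sum (drop r (map (λ s → f s + g s) U)) ≡ sum (drop r (map f U)) + sum (drop r (map g U))
sum-drop-map-+ r U f g = begin
  sum (drop r (map (λ s → f s + g s) U)) ≡⟨ cong sum (drop-map r U) ⟩
  sum (map (λ s → f s + g s) (drop r U)) ≡⟨ sum-map-+ f g (drop r U) ⟩
  sum (map f (drop r U)) + sum (map g (drop r U)) ≡⟨ sym (cong₂ _+_ (cong sum (drop-map r U)) (cong sum (drop-map r U))) ⟩
  sum (drop r (map f U)) + sum (drop r (map g U)) ∎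
  where open ≡-Reasoning

-- hits x r L is 1 if r < x ≤ L and 0 otherwise: the contribution of the index x
-- to the degree of φ in the variables x_{r+1}, …, x_L.
hits : ℕ → ℕ → ℕ → ℕ
hits x r L = sum (drop r (map (λ s → bit (suc s ≡ᵇ x)) (upTo L)))

hits-≤ : ∀ x r L → hits x r L ≤ ltBit r x
hits-≤ x r zero with r
... | zero = z≤n
... | suc _ = z≤n
hits-≤ zero r (suc L) = ≤-reflexive (sum-drop-zeros r (upTo (suc L)))
hits-≤ (suc x) r (suc L) rewrite map-upTo-suc (λ s → bit (s ≡ᵇ x)) L with r
... | suc r' = hits-≤ x r' L
... | zero with x
...   | zero = ≤-reflexive (cong suc (sum-drop-zeros 0 (upTo L)))
...   | suc x' = hits-≤ (suc x') 0 L

hits-≡ : ∀ x r L → x ≤ L → hits x r L ≡ ltBit r x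
hits-≡ zero r L _ = sum-drop-zeros r (upTo L)
hits-≡ (suc x) r (suc L) (s≤s p) rewrite map-upTo-suc (λ s → bit (s ≡ᵇ x)) L with r
... | suc r' = hits-≡ x r' L p
... | zero with x
...   | zero = cong suc (sum-drop-zeros 0 (upTo L))
...   | suc x' = hits-≡ (suc x') 0 L p

totalHits : ℕ → ℕ → List ℕ → ℕ
totalHits r L [] = 0
totalHits r L (x ∷ xs) = hits x r L + totalHits r L xs

if-suc≡bit+ : ∀ (b : Bool) n → (if b then suc n else n) ≡ bit b + n
if-suc≡bit+ true n = refl
if-suc≡bit+ false n = refl

sum-drop-cntEq : ∀ r L xs → sum (drop r (map (λ s → cntEq (suc s) xs) (upTo L))) ≡ totalHits r L xs
sum-drop-cntEq r L [] = sum-drop-zeros r (upTo L)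
sum-drop-cntEq r L (x ∷ xs) =
  trans (cong (λ U → sum (drop r U)) (map-cong (λ s → if-suc≡bit+ (suc s ≡ᵇ x) (cntEq (suc s) xs)) (upTo L)))
  (trans (sum-drop-map-+ r (upTo L) (λ s → bit (suc s ≡ᵇ x)) (λ s → cntEq (suc s) xs))
    (cong (hits x r L +_) (sum-drop-cntEq r L xs)))

totalHits-≤ : ∀ r L xs → totalHits r L xs ≤ countAbove r xs
totalHits-≤ r L [] = z≤n
totalHits-≤ r L (x ∷ xs) = +-mono-≤ (hits-≤ x r L) (totalHits-≤ r L xs)

totalHits-≡ : ∀ r L xs → All (_≤ L) xs → totalHits r L xs ≡ countAbove r xs
totalHits-≡ r L [] _ = refl
totalHits-≡ r L (x ∷ xs) (p ∷ ps) = cong₂ _+_ (hits-≡ x r L p) (totalHits-≡ r L xs ps)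

sum-drop-phiMon-≤ : ∀ r L bs → sum (drop r (phiMon L bs)) ≤ deepTrues 0 bs r
sum-drop-phiMon-≤ r L bs = begin
  sum (drop r (phiMon L bs)) ≡⟨ sum-drop-cntEq r L (phiIdx bs) ⟩
  totalHits r L (phiIdx bs) ≤⟨ totalHits-≤ r L (phiIdx bs) ⟩
  countAbove r (phiIdx bs) ≡⟨ phiIdx-countAbove r bs ⟩
  deepTrues 0 bs r ∎
  where open ≤-Reasoning

sum-drop-phiMon-≡ : ∀ r L bs → falses bs ≤ L → sum (drop r (phiMon L bs)) ≡ deepTrues 0 bs r
sum-drop-phiMon-≡ r L bs fb = begin
  sum (drop r (phiMon L bs)) ≡⟨ sum-drop-cntEq r L (phiIdx bs) ⟩
  totalHits r L (phiIdx bs) ≡⟨ totalHits-≡ r L (phiIdx bs) (All.map (λ p → ≤-trans p fb) (phiIdx-bounded bs)) ⟩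
  countAbove r (phiIdx bs) ≡⟨ phiIdx-countAbove r bs ⟩
  deepTrues 0 bs r ∎
  where open ≡-Reasoning

length-phiMon : ∀ L bs → length (phiMon L bs) ≡ L
length-phiMon L bs = trans (length-map _ (upTo L)) (length-applyUpTo id L)

SuffixDominated : List ℕ → List ℕ → Set
SuffixDominated M₂ M = ∀ r → sum (drop r M₂) ≤ sum (drop r M)

-- Exponents are chosen from the ≻-least variable (the end of the list) upwards,
-- each as large as M allows while the total stays at most D.
greedyDivisor : ℕ → List ℕ → List ℕ
greedyDivisor D [] = []
greedyDivisor D (x ∷ M) = (x ⊓ (D ∸ sum (greedyDivisor D M))) ∷ greedyDivisor D M

greedyDivisor-divides : ∀ D M → Divides (greedyDivisor D M) M
greedyDivisor-divides D [] = []
greedyDivisor-divides D (x ∷ M) = m⊓n≤m x _ ∷ greedyDivisor-divides D M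

deg-greedyDivisor : ∀ D M → deg (greedyDivisor D M) ≡ D ⊓ deg M
deg-greedyDivisor D [] = sym (⊓-zeroʳ D)
deg-greedyDivisor D (x ∷ M) rewrite deg-greedyDivisor D M with ≤-total D (sum M)
... | inj₁ D≤s rewrite m≤n⇒m⊓n≡m D≤s | n∸n≡0 D | ⊓-zeroʳ x =
  sym (m≤n⇒m⊓n≡m (≤-trans D≤s (m≤n+m (sum M) x)))
... | inj₂ s≤D rewrite m≥n⇒m⊓n≡n s≤D =
  trans (+-distribʳ-⊓ (sum M) x (D ∸ sum M)) (trans (cong ((x + sum M) ⊓_) (m∸n+n≡m s≤D)) (⊓-comm (x + sum M) D))

FirstDiffLt-++ : ∀ {P Q A B : List ℕ} → length A ≡ length B → FirstDiffLt P Q → FirstDiffLt (P ++ A) (Q ++ B)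
FirstDiffLt-++ lab (here {xs = xs} {ys = ys} lt l) =
  here lt (trans (length-++ xs) (trans (cong₂ _+_ l lab) (sym (length-++ ys))))
FirstDiffLt-++ lab (there p) = there (FirstDiffLt-++ lab p)

FirstDiffLt-last : ∀ (P : List ℕ) {x y} → x < y → FirstDiffLt (P ++ x ∷ []) (P ++ y ∷ [])
FirstDiffLt-last [] lt = here lt refl
FirstDiffLt-last (p ∷ P) lt = there (FirstDiffLt-last P lt)

∷-≻ᵐ : ∀ x y {M N} → M ≻ᵐ N → (x ∷ M) ≻ᵐ (y ∷ N)
∷-≻ᵐ x y {M} {N} p = subst₂ FirstDiffLt (sym (unfold-reverse x M)) (sym (unfold-reverse y N)) (FirstDiffLt-++ refl p)

∷-⪰ᵐ : ∀ {x y} M → x ≤ y → (x ∷ M) ⪰ᵐ (y ∷ M)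
∷-⪰ᵐ {x} {y} M x≤y with m≤n⇒m<n∨m≡n x≤y
... | inj₂ refl = inj₁ refl
... | inj₁ x<y = inj₂ (subst₂ FirstDiffLt (sym (unfold-reverse x M)) (sym (unfold-reverse y M))
                        (FirstDiffLt-last (reverse M) x<y))

greedyDivisor-head-≤ : ∀ x₂ x M D → x₂ + deg (greedyDivisor D M) ≤ x + deg M →
  x₂ + deg (greedyDivisor D M) ≤ D → x₂ ≤ x
greedyDivisor-head-≤ x₂ x M D h s with ≤-total (sum M) D
... | inj₁ sM≤D = +-cancelʳ-≤ (sum M) x₂ x
  (subst (λ z → x₂ + z ≤ x + sum M) (trans (deg-greedyDivisor D M) (m≥n⇒m⊓n≡n sM≤D)) h)
... | inj₂ D≤sM = ≤-trans (subst (x₂ ≤_) (n∸n≡0 D) x₂≤D∸D) z≤n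
  where
  x₂≤D∸D : x₂ ≤ D ∸ D
  x₂≤D∸D = m+n≤o⇒m≤o∸n x₂ (subst (λ z → x₂ + z ≤ D) (trans (deg-greedyDivisor D M) (m≤n⇒m⊓n≡m D≤sM)) s)

⪰ᵐ-greedyDivisor : ∀ M₂ M → length M₂ ≡ length M → SuffixDominated M₂ M →
  ∀ D → deg M₂ ≤ D → M₂ ⪰ᵐ greedyDivisor D M
⪰ᵐ-greedyDivisor [] [] l h D s = inj₁ refl
⪰ᵐ-greedyDivisor (x₂ ∷ M₂) (x ∷ M) l h D s
  with ⪰ᵐ-greedyDivisor M₂ M (suc-injective l) (h ∘ suc) D (≤-trans (m≤n+m (sum M₂) x₂) s)
... | inj₂ M₂≻ν = inj₂ (∷-≻ᵐ x₂ _ {M₂} {greedyDivisor D M} M₂≻ν)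
... | inj₁ refl = ∷-⪰ᵐ M₂ (⊓-glb (greedyDivisor-head-≤ x₂ x M D (h 0) s) (m+n≤o⇒m≤o∸n x₂ s))

suffixDominated⇒divisor : ∀ M₂ M → length M₂ ≡ length M → SuffixDominated M₂ M →
  deg M₂ ≤ deg M × Σ (List ℕ) (λ ν → Divides ν M × deg ν ≡ deg M₂ × M₂ ⪰ᵐ ν)
suffixDominated⇒divisor M₂ M l h =
  h 0 , greedyDivisor (deg M₂) M , greedyDivisor-divides (deg M₂) M ,
  trans (deg-greedyDivisor (deg M₂) M) (m≤n⇒m⊓n≡m (h 0)) , ⪰ᵐ-greedyDivisor M₂ M l h (deg M₂) ≤-refl

-- fillList e R turns the first e false entries of R into true: on the row of τ ∩ V_k
-- with e = a_k - |τ ∩ V_k| this is fill_k(τ), the revlex-first a_k-set containing τ ∩ V_k.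
fillHead : Bool → ℕ → Bool
fillHead true e = true
fillHead false zero = false
fillHead false (suc e) = true

fillBudget : Bool → ℕ → ℕ
fillBudget true e = e
fillBudget false e = pred e

fillList : ℕ → List Bool → List Bool
fillList e [] = []
fillList e (b ∷ bs) = fillHead b e ∷ fillList (fillBudget b e) bs

-- The part of a row lying in V[τ]: the leading run of trues of the filled row
-- has length a_k - deg Φ_k(τ).
trimList : ℕ → List Bool → List Bool
trimList e R = take (leadT (fillList e R)) R

fillList-zero : ∀ bs → fillList 0 bs ≡ bs
fillList-zero [] = refl
fillList-zero (true ∷ bs) = cong (true ∷_) (fillList-zero bs)
fillList-zero (false ∷ bs) = cong (false ∷_) (fillList-zero bs)

length-fillList : ∀ e R → length (fillList e R) ≡ length R
length-fillList e [] = refl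
length-fillList e (b ∷ R) = cong suc (length-fillList (fillBudget b e) R)

cntB-fillList : ∀ e R → e ≤ falses R → cntB (fillList e R) ≡ e + cntB R
cntB-fillList zero [] _ = refl
cntB-fillList e (true ∷ R) p = trans (cong suc (cntB-fillList e R p)) (sym (+-suc e (cntB R)))
cntB-fillList zero (false ∷ R) p = cntB-fillList zero R z≤n
cntB-fillList (suc e) (false ∷ R) (s≤s p) = cong suc (cntB-fillList e R p)

length-trimList-zero : ∀ R → length (trimList 0 R) ≡ leadT (fillList 0 R)
length-trimList-zero [] = refl
length-trimList-zero (true ∷ R) = cong suc (length-trimList-zero R)
length-trimList-zero (false ∷ R) = refl

falses-trimList-zero : ∀ R → falses (trimList 0 R) ≡ 0
falses-trimList-zero [] = refl
falses-trimList-zero (true ∷ R) = falses-trimList-zero R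
falses-trimList-zero (false ∷ R) = refl

falses-trimList-≤ : ∀ e R → falses (trimList e R) ≤ e
falses-trimList-≤ e [] = z≤n
falses-trimList-≤ e (true ∷ R) = falses-trimList-≤ e R
falses-trimList-≤ zero (false ∷ R) = z≤n
falses-trimList-≤ (suc e) (false ∷ R) = s≤s (falses-trimList-≤ e R)

falses-unset : ∀ W V → falses (W ++ false ∷ V) ≡ suc (falses (W ++ true ∷ V))
falses-unset [] V = refl
falses-unset (true ∷ W) V = falses-unset W V
falses-unset (false ∷ W) V = cong suc (falses-unset W V)

-- Unsetting an entry frees one unit of fill budget: the trimmed row then either
-- differs from the old one exactly at that entry, or extends it by a false followed by trues.
TrimAfterUnset : List Bool → List Bool → ℕ → Set
TrimAfterUnset A B e =
  (Σ (List Bool) λ W → Σ (List Bool) λ V →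
     trimList e (A ++ true ∷ B) ≡ W ++ true ∷ V × trimList (suc e) (A ++ false ∷ B) ≡ W ++ false ∷ V
     × leadT (fillList (suc e) (A ++ false ∷ B)) ≡ leadT (fillList e (A ++ true ∷ B)))
  ⊎ (Σ (List Bool) λ E →
     trimList (suc e) (A ++ false ∷ B) ≡ trimList e (A ++ true ∷ B) ++ false ∷ E × falses E ≡ 0
     × leadT (fillList (suc e) (A ++ false ∷ B)) ≡ leadT (fillList e (A ++ true ∷ B)) + suc (length E))

trimList-unset : ∀ A B e → TrimAfterUnset A B e
trimList-unset [] B e = inj₁ ([] , trimList e B , refl , refl , refl)
trimList-unset (true ∷ A) B e with trimList-unset A B e
... | inj₁ (W , V , p , q , l) = inj₁ (true ∷ W , V , cong (true ∷_) p , cong (true ∷_) q , cong suc l)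
... | inj₂ (E , p , f , l) = inj₂ (E , cong (true ∷_) p , f , cong suc l)
trimList-unset (false ∷ A) B (suc e) with trimList-unset A B e
... | inj₁ (W , V , p , q , l) = inj₁ (false ∷ W , V , cong (false ∷_) p , cong (false ∷_) q , cong suc l)
... | inj₂ (E , p , f , l) = inj₂ (E , cong (false ∷_) p , f , cong suc l)
trimList-unset (false ∷ A) B zero =
  inj₂ (trimList 0 (A ++ false ∷ B) , refl , falses-trimList-zero (A ++ false ∷ B) ,
        cong suc (sym (length-trimList-zero (A ++ false ∷ B))))

deepTrues-fillList-unset : ∀ A B e g r →
  deepTrues g (fillList (suc e) (A ++ false ∷ B)) r ≤ deepTrues g (fillList e (A ++ true ∷ B)) r
deepTrues-fillList-unset [] B e g r = ≤-refl
deepTrues-fillList-unset (true ∷ A) B e g r = +-monoʳ-≤ (ltBit r g) (deepTrues-fillList-unset A B e g r)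
deepTrues-fillList-unset (false ∷ A) B (suc e) g r = +-monoʳ-≤ (ltBit r g) (deepTrues-fillList-unset A B e g r)
deepTrues-fillList-unset (false ∷ A) B zero g r
  rewrite fillList-zero (A ++ false ∷ B) | fillList-zero (A ++ true ∷ B) = deepTrues-advanceTrue g [] A B r

fillList-truePrefix : ∀ X Y e → All (_≡ true) X →
  (fillList (suc e) (X ++ false ∷ Y) ≡ fillList e (X ++ true ∷ Y)) ×
  (trimList (suc e) (X ++ false ∷ Y) ≡ X ++ false ∷ trimList e Y) ×
  (trimList e (X ++ true ∷ Y) ≡ X ++ true ∷ trimList e Y)
fillList-truePrefix [] Y e [] = refl , refl , refl
fillList-truePrefix (.true ∷ X) Y e (refl ∷ ps) with fillList-truePrefix X Y e ps
... | p , q , s = cong (true ∷_) p , cong (true ∷_) q , cong (true ∷_) s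

deepTrues-fillList-advance : ∀ X Y Z e → All (_≡ true) X → ∀ g r →
  deepTrues g (fillList e (X ++ true ∷ Y ++ false ∷ Z)) r ≤ deepTrues g (fillList e (X ++ false ∷ Y ++ true ∷ Z)) r
deepTrues-fillList-advance (.true ∷ X) Y Z e (refl ∷ ps) g r =
  +-monoʳ-≤ (ltBit r g) (deepTrues-fillList-advance X Y Z e ps g r)
deepTrues-fillList-advance [] Y Z zero [] g r
  rewrite fillList-zero (Y ++ false ∷ Z) | fillList-zero (Y ++ true ∷ Z) = deepTrues-advanceTrue g [] Y Z r
deepTrues-fillList-advance [] Y Z (suc e) [] g r = +-monoʳ-≤ (ltBit r g) (deepTrues-fillList-unset Y Z e g r)

+-suc-mono-≤ : ∀ a {b c d e} → b + c ≤ d + e → a + b + suc c ≤ a + d + suc e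
+-suc-mono-≤ a {b} {c} {d} {e} h = begin
  a + b + suc c     ≡⟨ +-suc (a + b) c ⟩
  suc (a + b + c)   ≡⟨ cong suc (+-assoc a b c) ⟩
  suc (a + (b + c)) ≤⟨ s≤s (+-monoʳ-≤ a h) ⟩
  suc (a + (d + e)) ≡⟨ cong suc (sym (+-assoc a d e)) ⟩
  suc (a + d + e)   ≡⟨ sym (+-suc (a + d) e) ⟩
  a + d + suc e     ∎
  where open ≤-Reasoning

deepTrues-trimList-advance : ∀ X Y Z e → All (_≡ true) X → ∀ g r →
  deepTrues g (trimList e (X ++ true ∷ Y ++ false ∷ Z)) r + leadT (fillList e (X ++ false ∷ Y ++ true ∷ Z))
   ≤ deepTrues g (trimList e (X ++ false ∷ Y ++ true ∷ Z)) r + leadT (fillList e (X ++ true ∷ Y ++ false ∷ Z))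
deepTrues-trimList-advance (.true ∷ X) Y Z e (refl ∷ ps) g r =
  +-suc-mono-≤ (ltBit r g) (deepTrues-trimList-advance X Y Z e ps g r)
deepTrues-trimList-advance [] Y Z zero [] g r = begin
  deepTrues g T r + 0 ≡⟨ +-identityʳ _ ⟩
  deepTrues g T r     ≤⟨ deepTrues-≤-length g T r ⟩
  length T            ≡⟨ length-trimList-zero (true ∷ Y ++ false ∷ Z) ⟩
  leadT (fillList 0 (true ∷ Y ++ false ∷ Z)) ∎
  where
  open ≤-Reasoning
  T = trimList 0 (true ∷ Y ++ false ∷ Z)
deepTrues-trimList-advance [] Y Z (suc e) [] g r with trimList-unset Y Z e
... | inj₁ (W , V , p , q , l) rewrite p | q | l = +-monoˡ-≤ _ (deepTrues-advanceTrue g [] W V r)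
... | inj₂ (E , p , f , l) rewrite p | l = begin
  deepTrues g (true ∷ Q ++ false ∷ E) r + suc ℓ
    ≡⟨ cong (λ z → deepTrues g (true ∷ Q ++ false ∷ z) r + suc ℓ) (sym (++-identityʳ E)) ⟩
  deepTrues g (true ∷ Q ++ false ∷ E ++ []) r + suc ℓ
    ≤⟨ +-monoˡ-≤ (suc ℓ) (deepTrues-advanceTrue-dropTrues g [] Q E [] r f) ⟩
  deepTrues g (false ∷ Q ++ []) r + suc (length E) + suc ℓ
    ≡⟨ cong (λ z → deepTrues g (false ∷ z) r + suc (length E) + suc ℓ) (++-identityʳ Q) ⟩
  deepTrues g (false ∷ Q) r + suc (length E) + suc ℓ
    ≡⟨ solve 3 (λ x y z → x :+ (con 1 :+ y) :+ (con 1 :+ z) := x :+ (con 1 :+ (z :+ (con 1 :+ y)))) refl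
         (deepTrues g (false ∷ Q) r) (length E) ℓ ⟩
  deepTrues g (false ∷ Q) r + suc (ℓ + suc (length E)) ∎
  where
  open ≤-Reasoning
  Q = trimList e (Y ++ true ∷ Z)
  ℓ = leadT (fillList e (Y ++ true ∷ Z))

falses-trimList-advance : ∀ X Y Z e → All (_≡ true) X →
  falses (trimList e (X ++ true ∷ Y ++ false ∷ Z)) ≤ falses (trimList e (X ++ false ∷ Y ++ true ∷ Z))
falses-trimList-advance (.true ∷ X) Y Z e (refl ∷ ps) = falses-trimList-advance X Y Z e ps
falses-trimList-advance [] Y Z zero [] = ≤-reflexive (falses-trimList-zero (true ∷ Y ++ false ∷ Z))
falses-trimList-advance [] Y Z (suc e) [] with trimList-unset Y Z e
... | inj₁ (W , V , p , q , l) rewrite p | q = ≤-reflexive (falses-unset W V)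
... | inj₂ (E , p , f , l) rewrite p =
  ≤-reflexive (trans (falses-++ (trimList e (Y ++ true ∷ Z)) (false ∷ E))
    (trans (+-suc _ _) (cong suc (trans (cong (_ +_) f) (+-identityʳ _)))))

cntB-unset : ∀ X Y → cntB (X ++ true ∷ Y) ≡ suc (cntB (X ++ false ∷ Y))
cntB-unset [] Y = refl
cntB-unset (true ∷ X) Y = cong suc (cntB-unset X Y)
cntB-unset (false ∷ X) Y = cntB-unset X Y

cntB-advanceTrue : ∀ A B C → cntB (A ++ true ∷ B ++ false ∷ C) ≡ cntB (A ++ false ∷ B ++ true ∷ C)
cntB-advanceTrue (true ∷ A) B C = cong suc (cntB-advanceTrue A B C)
cntB-advanceTrue (false ∷ A) B C = cntB-advanceTrue A B C
cntB-advanceTrue [] B C = sym (cntB-unset B C)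

cntB-∷ : ∀ b l → cntB (b ∷ l) ≡ bit b + cntB l
cntB-∷ true l = refl
cntB-∷ false l = refl

countTrue : ∀ {n} → (Fin n → Bool) → ℕ
countTrue f = cntB (tabulate f)

map-allFin : ∀ {n} (F : Fin n → Bool) → map F (allFin n) ≡ tabulate F
map-allFin F = map-tabulate id F

bit-mono : (b c : Bool) → (b ≡ true → c ≡ true) → bit b ≤ bit c
bit-mono true c h rewrite h refl = ≤-refl
bit-mono false c h = z≤n

countTrue-mono : ∀ {N} (f g : Fin N → Bool) → (∀ x → f x ≡ true → g x ≡ true) → countTrue f ≤ countTrue g
countTrue-mono {zero} f g h = z≤n
countTrue-mono {suc N} f g h = subst₂ _≤_ (sym (cntB-∷ (f fzero) _)) (sym (cntB-∷ (g fzero) _))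
  (+-mono-≤ (bit-mono (f fzero) (g fzero) (h fzero)) (countTrue-mono (f ∘ fsuc) (g ∘ fsuc) (h ∘ fsuc)))

countTrue-strict : ∀ {N} (f g : Fin N → Bool) → (∀ x → f x ≡ true → g x ≡ true) →
  ∀ x → f x ≡ false → g x ≡ true → countTrue f < countTrue g
countTrue-strict {suc N} f g h fzero fx gx = subst₂ _<_ (sym (cntB-∷ (f fzero) _)) (sym (cntB-∷ (g fzero) _))
  (subst₂ (λ p q → p + countTrue (f ∘ fsuc) < q + countTrue (g ∘ fsuc)) (sym (cong bit fx)) (sym (cong bit gx))
     (s≤s (countTrue-mono (f ∘ fsuc) (g ∘ fsuc) (h ∘ fsuc))))
countTrue-strict {suc N} f g h (fsuc x) fx gx = subst₂ _<_ (sym (cntB-∷ (f fzero) _)) (sym (cntB-∷ (g fzero) _))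
  (+-mono-≤-< (bit-mono (f fzero) (g fzero) (h fzero)) (countTrue-strict (f ∘ fsuc) (g ∘ fsuc) (h ∘ fsuc) x fx gx))

fillFun : ∀ {n} → ℕ → (Fin n → Bool) → Fin n → Bool
fillFun {suc n} e f fzero = fillHead (f fzero) e
fillFun {suc n} e f (fsuc x) = fillFun (fillBudget (f fzero) e) (f ∘ fsuc) x

tabulate-fillFun : ∀ {n} e (f : Fin n → Bool) → tabulate (fillFun e f) ≡ fillList e (tabulate f)
tabulate-fillFun {zero} e f = refl
tabulate-fillFun {suc n} e f = cong (fillHead (f fzero) e ∷_) (tabulate-fillFun (fillBudget (f fzero) e) (f ∘ fsuc))

fillFun-⊇ : ∀ {n} e (f : Fin n → Bool) j → f j ≡ true → fillFun e f j ≡ true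
fillFun-⊇ {suc n} e f fzero p rewrite p = refl
fillFun-⊇ {suc n} e f (fsuc j) p = fillFun-⊇ (fillBudget (f fzero) e) (f ∘ fsuc) j p

-- The count hypothesis is carried in the form used by the induction: either the
-- budget is exhausted, or G has at least as many trues as the fill.
fillHead-step : ∀ b e g (cC cG : ℕ) → (b ≡ true → g ≡ true) →
  (e ≡ 0 ⊎ bit (fillHead b e) + cC ≤ bit g + cG) → (fillBudget b e ≡ 0 ⊎ cC ≤ cG)
fillHead-step true e g cC cG sub (inj₁ e0) = inj₁ e0
fillHead-step true e g cC cG sub (inj₂ le) rewrite sub refl = inj₂ (+-cancelˡ-≤ 1 cC cG le)
fillHead-step false zero g cC cG sub h = inj₁ refl
fillHead-step false (suc e) g cC cG sub (inj₁ ())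
fillHead-step false (suc e) true cC cG sub (inj₂ le) = inj₂ (+-cancelˡ-≤ 1 cC cG le)
fillHead-step false (suc e) false cC cG sub (inj₂ le) = inj₂ (≤-trans (n≤1+n cC) le)

fillHead-differ : ∀ b e g (c : ℕ) → (b ≡ true → g ≡ true) → (e ≡ 0 ⊎ bit (fillHead b e) + c ≤ bit g + c) →
  g ≢ fillHead b e → g ≡ true × fillHead b e ≡ false
fillHead-differ true e g c sub h d = ⊥-elim (d (sub refl))
fillHead-differ false zero true c sub h d = refl , refl
fillHead-differ false zero false c sub h d = ⊥-elim (d refl)
fillHead-differ false (suc e) true c sub h d = ⊥-elim (d refl)
fillHead-differ false (suc e) false c sub (inj₁ ()) d
fillHead-differ false (suc e) false c sub (inj₂ le) d = ⊥-elim (<-irrefl refl le)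

≢-stable : {b c : Bool} → ¬ (b ≢ c) → b ≡ c
≢-stable {b} {c} = decidable-stable (b Bool.≟ c)

fillFun-revlexFirst : ∀ {n} (f : Fin n → Bool) e (G : Fin n → Bool) → (∀ j → f j ≡ true → G j ≡ true) →
  (e ≡ 0 ⊎ countTrue (fillFun e f) ≤ countTrue G) → Σ (Fin n) (λ j → G j ≢ fillFun e f j) →
  RevGtSet toℕ (fillFun e f) G
fillFun-revlexFirst {suc n} f e G sub h (j , dj)
  with any? (λ x → ¬? (G (fsuc x) Bool.≟ fillFun e f (fsuc x)))
... | yes (x , dx) =
  let (u , Gu , Cu , maxU) = fillFun-revlexFirst (f ∘ fsuc) e′ (G ∘ fsuc) (sub ∘ fsuc) h′ (x , dx)
  in fsuc u , Gu , Cu , λ { fzero _ → z≤n ; (fsuc y) d → s≤s (maxU y d) }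
  where
  e′ = fillBudget (f fzero) e
  h′ : e′ ≡ 0 ⊎ countTrue (fillFun e′ (f ∘ fsuc)) ≤ countTrue (G ∘ fsuc)
  h′ = fillHead-step (f fzero) e (G fzero) _ _ (sub fzero)
         (Sum.map₂ (subst₂ _≤_ (cntB-∷ (fillHead (f fzero) e) _) (cntB-∷ (G fzero) _)) h)
... | no agreeAfter = fzero , proj₁ head , proj₂ head , λ { fzero _ → z≤n ; (fsuc y) d → ⊥-elim (d (sym (tails y))) }
  where
  e′ = fillBudget (f fzero) e
  tails : ∀ x → G (fsuc x) ≡ fillFun e f (fsuc x)
  tails x = ≢-stable (λ d → agreeAfter (x , d))
  differs₀ : ∀ i → G i ≢ fillFun e f i → G fzero ≢ fillHead (f fzero) e
  differs₀ fzero di = di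
  differs₀ (fsuc y) di = ⊥-elim (di (tails y))
  rest = countTrue (fillFun e′ (f ∘ fsuc))
  h₀ : e ≡ 0 ⊎ bit (fillHead (f fzero) e) + rest ≤ bit (G fzero) + rest
  h₀ = Sum.map₂ (subst₂ _≤_ (cntB-∷ (fillHead (f fzero) e) _)
         (trans (cntB-∷ (G fzero) _) (cong (bit (G fzero) +_) (cong cntB (tabulate-cong tails))))) h
  head : G fzero ≡ true × fillHead (f fzero) e ≡ false
  head = fillHead-differ (f fzero) e (G fzero) rest (sub fzero) h₀ (differs₀ j dj)

RevGtSet-asym : ∀ {n} {S T : Fin n → Bool} → RevGtSet toℕ S T → ¬ RevGtSet toℕ T S
RevGtSet-asym {S = S} {T} (u , Tu , Su , maxU) (u′ , Su′ , Tu′ , maxU′) with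
  toℕ-injective (≤-antisym (maxU′ u (λ q → contradiction (trans (sym Tu) (trans q Su)) λ ()))
                           (maxU u′ (λ q → contradiction (trans (sym Su′) (trans q Tu′)) λ ())))
... | refl = contradiction (trans (sym Tu) Tu′) λ ()

-- Setup.IsFillBlock, stated for a single block.
IsRevlexFirstFill : (n a : ℕ) → (Fin n → Bool) → (Fin n → Bool) → Set
IsRevlexFirstFill n a t F = cntB (map F (allFin n)) ≡ a ×
  (∀ j → t j ≡ true → F j ≡ true) ×
  (∀ (G : Fin n → Bool) → cntB (map G (allFin n)) ≡ a →
     (∀ j → t j ≡ true → G j ≡ true) →
     Σ (Fin n) (λ j → G j ≢ F j) → RevGtSet toℕ F G)

revlexFirstFill-unique : ∀ n a (t F : Fin n → Bool) → IsRevlexFirstFill n a t F → countTrue t ≤ a → a ≤ n →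
  ∀ j → F j ≡ fillFun (a ∸ countTrue t) t j
revlexFirstFill-unique n a t F (cntF , F⊇t , F-first) ct an j
  with any? (λ x → ¬? (F x Bool.≟ fillFun (a ∸ countTrue t) t x))
... | no nd = ≢-stable (λ d → nd (j , d))
... | yes (x , dx) = ⊥-elim (
  RevGtSet-asym (F-first C cntC (fillFun-⊇ e t) (x , λ q → dx (sym q)))
                (fillFun-revlexFirst t e F F⊇t (inj₂ (≤-reflexive countC≡countF)) (x , dx)))
  where
  e = a ∸ countTrue t
  C = fillFun e t
  e≤falses : e ≤ falses (tabulate t)
  e≤falses = subst (e ≤_) (m+n∸m≡n (countTrue t) (falses (tabulate t)))
    (∸-monoˡ-≤ (countTrue t) (subst (a ≤_) (sym (trans (cntB+falses (tabulate t)) (length-tabulate t))) an))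
  cntC : cntB (map C (allFin n)) ≡ a
  cntC = trans (cong cntB (trans (map-allFin C) (tabulate-fillFun e t)))
               (trans (cntB-fillList e (tabulate t) e≤falses) (m∸n+n≡m ct))
  countC≡countF : countTrue C ≡ countTrue F
  countC≡countF = trans (trans (cong cntB (sym (map-allFin C))) cntC) (sym (trans (cong cntB (sym (map-allFin F))) cntF))

tabulate-split : ∀ {n} (f : Fin n → Bool) (p : Fin n) → Σ (List Bool) λ A → Σ (List Bool) λ B →
  (∀ g → (∀ x → x ≢ p → g x ≡ f x) → tabulate g ≡ A ++ g p ∷ B) ×
  ((∀ x → toℕ x < toℕ p → f x ≡ true) → All (_≡ true) A)
tabulate-split {suc n} f fzero = [] , tabulate (f ∘ fsuc) ,
  (λ g eq → cong (g fzero ∷_) (tabulate-cong (λ x → eq (fsuc x) (λ ())))) , (λ _ → [])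
tabulate-split {suc n} f (fsuc p) with tabulate-split (f ∘ fsuc) p
... | A , B , tg , ta = f fzero ∷ A , B ,
  (λ g eq → cong₂ _∷_ (eq fzero (λ ())) (tg (g ∘ fsuc) (λ x ne → eq (fsuc x) (ne ∘ Fin.suc-injective)))) ,
  (λ h → h fzero (s≤s z≤n) ∷ ta (λ x lt → h (fsuc x) (s≤s lt)))

tabulate-split₂ : ∀ {n} (f : Fin n → Bool) (p j : Fin n) → toℕ p < toℕ j →
  Σ (List Bool) λ A → Σ (List Bool) λ B → Σ (List Bool) λ C →
  (∀ g → (∀ x → x ≢ p → x ≢ j → g x ≡ f x) → tabulate g ≡ A ++ g p ∷ B ++ g j ∷ C) ×
  ((∀ x → toℕ x < toℕ p → f x ≡ true) → All (_≡ true) A)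
tabulate-split₂ {suc n} f fzero (fsuc j) lt with tabulate-split (f ∘ fsuc) j
... | B , C , tg , _ = [] , B , C ,
  (λ g eq → cong (g fzero ∷_) (tg (g ∘ fsuc) (λ x ne → eq (fsuc x) (λ ()) (ne ∘ Fin.suc-injective)))) , (λ _ → [])
tabulate-split₂ {suc n} f (fsuc p) (fsuc j) (s≤s lt) with tabulate-split₂ (f ∘ fsuc) p j lt
... | A , B , C , tg , ta = f fzero ∷ A , B , C ,
  (λ g eq → cong₂ _∷_ (eq fzero (λ ()) (λ ()))
              (tg (g ∘ fsuc) (λ x ne₁ ne₂ → eq (fsuc x) (ne₁ ∘ Fin.suc-injective) (ne₂ ∘ Fin.suc-injective)))) ,
  (λ h → h fzero (s≤s z≤n) ∷ ta (λ x lt → h (fsuc x) (s≤s lt)))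

allFin-suc : ∀ m → allFin (suc m) ≡ fzero ∷ map fsuc (allFin m)
allFin-suc m = cong (fzero ∷_) (sym (map-tabulate id fsuc))

allFin-split : ∀ {m} (i : Fin m) → Σ (List (Fin m)) λ L₁ → Σ (List (Fin m)) λ L₂ →
  allFin m ≡ L₁ ++ i ∷ L₂ × All (_≢ i) L₁ × All (_≢ i) L₂
allFin-split {suc m} fzero = [] , tabulate fsuc , refl , [] , tabulate⁺ (λ x ())
allFin-split {suc m} (fsuc i) with allFin-split i
... | L₁ , L₂ , e , a₁ , a₂ = fzero ∷ map fsuc L₁ , map fsuc L₂ ,
  trans (allFin-suc m) (cong (fzero ∷_) (trans (cong (map fsuc) e) (map-++ fsuc L₁ (i ∷ L₂)))) ,
  (λ ()) ∷ map⁺ (All.map (_∘ Fin.suc-injective) a₁) , map⁺ (All.map (_∘ Fin.suc-injective) a₂)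

allFin-split₂ : ∀ {m} (k i : Fin m) → toℕ k < toℕ i →
  Σ (List (Fin m)) λ L₁ → Σ (List (Fin m)) λ L₂ → Σ (List (Fin m)) λ L₃ →
  allFin m ≡ L₁ ++ k ∷ L₂ ++ i ∷ L₃ ×
  All (λ x → x ≢ k × x ≢ i) L₁ × All (λ x → x ≢ k × x ≢ i) L₂ × All (λ x → x ≢ k × x ≢ i) L₃
allFin-split₂ {suc m} fzero (fsuc i) lt with allFin-split i
... | L₁ , L₂ , e , a₁ , a₂ = [] , map fsuc L₁ , map fsuc L₂ ,
  trans (allFin-suc m) (cong (fzero ∷_) (trans (cong (map fsuc) e) (map-++ fsuc L₁ (i ∷ L₂)))) ,
  [] , map⁺ (All.map (λ ne → (λ ()) , ne ∘ Fin.suc-injective) a₁) ,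
       map⁺ (All.map (λ ne → (λ ()) , ne ∘ Fin.suc-injective) a₂)
allFin-split₂ {suc m} (fsuc k) (fsuc i) (s≤s lt) with allFin-split₂ k i lt
... | L₁ , L₂ , L₃ , e , a₁ , a₂ , a₃ = fzero ∷ map fsuc L₁ , map fsuc L₂ , map fsuc L₃ ,
  trans (allFin-suc m) (cong (fzero ∷_) (trans (cong (map fsuc) e) (trans (map-++ fsuc L₁ (k ∷ L₂ ++ i ∷ L₃))
     (cong (map fsuc L₁ ++_) (cong (fsuc k ∷_) (map-++ fsuc L₂ (i ∷ L₃))))))) ,
  ((λ ()) , (λ ())) ∷ map⁺ (All.map lift a₁) , map⁺ (All.map lift a₂) , map⁺ (All.map lift a₃)
  where
  lift : ∀ {y} → (y ≢ k × y ≢ i) → (fsuc y ≢ fsuc k × fsuc y ≢ fsuc i)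
  lift (ne₁ , ne₂) = ne₁ ∘ Fin.suc-injective , ne₂ ∘ Fin.suc-injective

concatMap-congᴬ : ∀ {X Y : Set} {h h′ : X → List Y} {L : List X} → All (λ x → h x ≡ h′ x) L →
  concatMap h L ≡ concatMap h′ L
concatMap-congᴬ [] = refl
concatMap-congᴬ (p ∷ ps) = cong₂ _++_ p (concatMap-congᴬ ps)

concatMap-split₂ : ∀ {X Y : Set} (h : X → List Y) L₁ k L₂ i L₃ →
  concatMap h (L₁ ++ k ∷ L₂ ++ i ∷ L₃) ≡ concatMap h L₁ ++ h k ++ concatMap h L₂ ++ h i ++ concatMap h L₃
concatMap-split₂ h L₁ k L₂ i L₃ =
  trans (concatMap-++ h L₁ (k ∷ L₂ ++ i ∷ L₃)) (cong (λ z → concatMap h L₁ ++ h k ++ z) (concatMap-++ h L₂ (i ∷ L₃)))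

falses-concatMap : ∀ {X : Set} (h : X → List Bool) L → falses (concatMap h L) ≡ sum (map (falses ∘ h) L)
falses-concatMap h [] = refl
falses-concatMap h (x ∷ L) = trans (falses-++ (h x) (concatMap h L)) (cong (falses (h x) +_) (falses-concatMap h L))

sum-drop-++ˡ : ∀ r (A B : List ℕ) → r ≤ length A → sum (drop r (A ++ B)) ≡ sum (drop r A) + sum B
sum-drop-++ˡ zero A B _ = sum-++ A B
sum-drop-++ˡ (suc r) (x ∷ A) B (s≤s p) = sum-drop-++ˡ r A B p

drop-++ʳ : ∀ {X : Set} s (A B : List X) → drop (length A + s) (A ++ B) ≡ drop s B
drop-++ʳ s [] B = refl
drop-++ʳ s (x ∷ A) B = drop-++ʳ s A B

+-exchange-≤ : ∀ x′ y′ x y ℓ ℓ′ → x′ + ℓ ≤ x + ℓ′ → y′ + ℓ′ ≡ y + ℓ → x′ + y′ ≤ x + y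
+-exchange-≤ x′ y′ x y ℓ ℓ′ h e = +-cancelʳ-≤ ℓ (x′ + y′) (x + y) (begin
  x′ + y′ + ℓ   ≡⟨ solve 3 (λ a b c → a :+ b :+ c := a :+ c :+ b) refl x′ y′ ℓ ⟩
  x′ + ℓ + y′   ≤⟨ +-monoˡ-≤ y′ h ⟩
  x + ℓ′ + y′   ≡⟨ +-assoc x ℓ′ y′ ⟩
  x + (ℓ′ + y′) ≡⟨ cong (x +_) (trans (+-comm ℓ′ y′) e) ⟩
  x + (y + ℓ)   ≡⟨ sym (+-assoc x y ℓ) ⟩
  x + y + ℓ     ∎)
  where open ≤-Reasoning

-- μ_{X_0 ∪ X_i} = φ(T) ++ φ(Fr): a suffix starting in the X_0 part contains all of
-- φ(Fr), whose degree is a_i minus the leading run of Fr.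
suffixDominated-phiMon-++ : ∀ (c L a : ℕ) (T T′ Fr Fr′ : List Bool) →
  falses T ≤ c → falses Fr ≤ L →
  deepTrues 0 Fr 0 + leadT Fr ≡ a → deepTrues 0 Fr′ 0 + leadT Fr′ ≡ a →
  (∀ s → deepTrues 0 Fr′ s ≤ deepTrues 0 Fr s) →
  (∀ r → deepTrues 0 T′ r + leadT Fr ≤ deepTrues 0 T r + leadT Fr′) →
  SuffixDominated (phiMon c T′ ++ phiMon L Fr′) (phiMon c T ++ phiMon L Fr)
suffixDominated-phiMon-++ c L a T T′ Fr Fr′ capT capF eF eF′ hI hII r with ≤-total r c
... | inj₁ r≤c = begin
  sum (drop r (phiMon c T′ ++ phiMon L Fr′))       ≡⟨ sum-drop-++ˡ r _ _ (subst (r ≤_) (sym (length-phiMon c T′)) r≤c) ⟩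
  sum (drop r (phiMon c T′)) + sum (phiMon L Fr′)   ≤⟨ +-mono-≤ (sum-drop-phiMon-≤ r c T′) (sum-drop-phiMon-≤ 0 L Fr′) ⟩
  deepTrues 0 T′ r + deepTrues 0 Fr′ 0
    ≤⟨ +-exchange-≤ _ _ _ _ (leadT Fr) (leadT Fr′) (hII r) (trans eF′ (sym eF)) ⟩
  deepTrues 0 T r + deepTrues 0 Fr 0               ≡⟨ sym (cong₂ _+_ (sum-drop-phiMon-≡ r c T capT) (sum-drop-phiMon-≡ 0 L Fr capF)) ⟩
  sum (drop r (phiMon c T)) + sum (phiMon L Fr)     ≡⟨ sym (sum-drop-++ˡ r _ _ (subst (r ≤_) (sym (length-phiMon c T)) r≤c)) ⟩
  sum (drop r (phiMon c T ++ phiMon L Fr))         ∎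
  where open ≤-Reasoning
... | inj₂ c≤r = begin
  sum (drop r (phiMon c T′ ++ phiMon L Fr′))  ≡⟨ cong sum (trans (cong (λ z → drop z _) (r≡ T′)) (drop-++ʳ s (phiMon c T′) _)) ⟩
  sum (drop s (phiMon L Fr′))                 ≤⟨ sum-drop-phiMon-≤ s L Fr′ ⟩
  deepTrues 0 Fr′ s                           ≤⟨ hI s ⟩
  deepTrues 0 Fr s                            ≡⟨ sym (sum-drop-phiMon-≡ s L Fr capF) ⟩
  sum (drop s (phiMon L Fr))                  ≡⟨ sym (cong sum (trans (cong (λ z → drop z _) (r≡ T)) (drop-++ʳ s (phiMon c T) _))) ⟩
  sum (drop r (phiMon c T ++ phiMon L Fr))    ∎
  where
  open ≤-Reasoning
  s = r ∸ c
  r≡ : ∀ U → r ≡ length (phiMon c U) + s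
  r≡ U = trans (sym (m+[n∸m]≡n c≤r)) (cong (_+ s) (sym (length-phiMon c U)))

length-phiMon-++ : ∀ c L T T′ Fr Fr′ → length (phiMon c T′ ++ phiMon L Fr′) ≡ length (phiMon c T ++ phiMon L Fr)
length-phiMon-++ c L T T′ Fr Fr′ =
  trans (length-++ (phiMon c T′)) (trans (cong₂ _+_ (length-phiMon c T′) (length-phiMon L Fr′))
    (sym (trans (length-++ (phiMon c T)) (cong₂ _+_ (length-phiMon c T) (length-phiMon L Fr)))))

deepTrues-replaceMiddle : ∀ P Q Q′ S ℓ ℓ′ → (∀ g r → deepTrues g Q′ r + ℓ ≤ deepTrues g Q r + ℓ′) →
  falses Q′ ≤ falses Q → ∀ r → deepTrues 0 (P ++ Q′ ++ S) r + ℓ ≤ deepTrues 0 (P ++ Q ++ S) r + ℓ′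
deepTrues-replaceMiddle P Q Q′ S ℓ ℓ′ h fq r = begin
  deepTrues 0 (P ++ Q′ ++ S) r + ℓ ≡⟨ cong (_+ ℓ) (split Q′) ⟩
  p + (q′ + s′) + ℓ                ≡⟨ shuffle p q′ s′ ℓ ⟩
  p + (q′ + ℓ) + s′                ≤⟨ +-mono-≤ (+-monoʳ-≤ p (h (falses P) r)) (deepTrues-mono S r (+-monoʳ-≤ (falses P) fq)) ⟩
  p + (q + ℓ′) + s                 ≡⟨ sym (shuffle p q s ℓ′) ⟩
  p + (q + s) + ℓ′                 ≡⟨ cong (_+ ℓ′) (sym (split Q)) ⟩
  deepTrues 0 (P ++ Q ++ S) r + ℓ′ ∎
  where
  open ≤-Reasoning
  p = deepTrues 0 P r
  q′ = deepTrues (falses P) Q′ r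
  q = deepTrues (falses P) Q r
  s′ = deepTrues (falses P + falses Q′) S r
  s = deepTrues (falses P + falses Q) S r
  split : ∀ R → deepTrues 0 (P ++ R ++ S) r ≡ p + (deepTrues (falses P) R r + deepTrues (falses P + falses R) S r)
  split R = trans (deepTrues-++ 0 P (R ++ S) r) (cong (p +_) (deepTrues-++ (falses P) R S r))
  shuffle : ∀ x y z u → x + (y + z) + u ≡ x + (y + u) + z
  shuffle = solve 4 (λ x y z u → x :+ (y :+ z) :+ u := x :+ (y :+ u) :+ z) refl

++-reassoc : ∀ {A : Set} (P X U R : List A) b → P ++ (X ++ b ∷ U) ++ R ≡ (P ++ X) ++ b ∷ U ++ R
++-reassoc P X U R b = trans (cong (P ++_) (++-assoc X (b ∷ U) R)) (sym (++-assoc P X _))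

++-reassoc₂ : ∀ {A : Set} (P X U Mid W V S : List A) b c →
  P ++ (X ++ b ∷ U) ++ Mid ++ (W ++ c ∷ V) ++ S ≡ (P ++ X) ++ b ∷ (U ++ Mid ++ W) ++ c ∷ (V ++ S)
++-reassoc₂ P X U Mid W V S b c = begin
  P ++ (X ++ b ∷ U) ++ Mid ++ (W ++ c ∷ V) ++ S ≡⟨ ++-reassoc P X U _ b ⟩
  (P ++ X) ++ b ∷ U ++ Mid ++ (W ++ c ∷ V) ++ S ≡⟨ cong (λ z → (P ++ X) ++ b ∷ U ++ Mid ++ z) (++-assoc W (c ∷ V) S) ⟩
  (P ++ X) ++ b ∷ U ++ Mid ++ W ++ c ∷ (V ++ S) ≡⟨ cong (λ z → (P ++ X) ++ b ∷ U ++ z) (sym (++-assoc Mid W _)) ⟩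
  (P ++ X) ++ b ∷ U ++ (Mid ++ W) ++ c ∷ (V ++ S) ≡⟨ cong (λ z → (P ++ X) ++ b ∷ z) (sym (++-assoc U (Mid ++ W) _)) ⟩
  (P ++ X) ++ b ∷ (U ++ Mid ++ W) ++ c ∷ (V ++ S) ∎
  where open ≡-Reasoning

-- A true moves from the row Q′ into an earlier row X ++ _ ∷ U; the two shapes of
-- the later row are those of TrimAfterUnset.
deepTrues-crossRows : ∀ P X U Mid S Q Q′ ℓ ℓ′ →
  ((Σ (List Bool) λ W → Σ (List Bool) λ V → Q ≡ W ++ true ∷ V × Q′ ≡ W ++ false ∷ V × ℓ′ ≡ ℓ)
   ⊎ (Σ (List Bool) λ E → Q′ ≡ Q ++ false ∷ E × falses E ≡ 0 × ℓ′ ≡ ℓ + suc (length E))) →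
  ∀ r → deepTrues 0 (P ++ (X ++ true ∷ U) ++ Mid ++ Q′ ++ S) r + ℓ
      ≤ deepTrues 0 (P ++ (X ++ false ∷ U) ++ Mid ++ Q ++ S) r + ℓ′
deepTrues-crossRows P X U Mid S .(W ++ true ∷ V) .(W ++ false ∷ V) ℓ .ℓ (inj₁ (W , V , refl , refl , refl)) r
  rewrite ++-reassoc₂ P X U Mid W V S true false | ++-reassoc₂ P X U Mid W V S false true =
  +-monoˡ-≤ ℓ (deepTrues-advanceTrue 0 (P ++ X) (U ++ Mid ++ W) (V ++ S) r)
deepTrues-crossRows P X U Mid S Q .(Q ++ false ∷ E) ℓ .(ℓ + suc (length E)) (inj₂ (E , refl , f , refl)) r
  rewrite ++-reassoc₂ P X U Mid Q E S true false | ++-reassoc P X U (Mid ++ Q ++ S) false = begin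
  deepTrues 0 ((P ++ X) ++ true ∷ (U ++ Mid ++ Q) ++ false ∷ (E ++ S)) r + ℓ
    ≤⟨ +-monoˡ-≤ ℓ (deepTrues-advanceTrue-dropTrues 0 (P ++ X) (U ++ Mid ++ Q) E S r f) ⟩
  deepTrues 0 ((P ++ X) ++ false ∷ (U ++ Mid ++ Q) ++ S) r + suc (length E) + ℓ
    ≡⟨ trans (+-assoc _ (suc (length E)) ℓ) (cong (deepTrues 0 ((P ++ X) ++ false ∷ (U ++ Mid ++ Q) ++ S) r +_) (+-comm (suc (length E)) ℓ)) ⟩
  deepTrues 0 ((P ++ X) ++ false ∷ (U ++ Mid ++ Q) ++ S) r + (ℓ + suc (length E))
    ≡⟨ cong (λ z → deepTrues 0 ((P ++ X) ++ false ∷ z) r + (ℓ + suc (length E))) reassoc ⟩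
  deepTrues 0 ((P ++ X) ++ false ∷ U ++ Mid ++ Q ++ S) r + (ℓ + suc (length E)) ∎
  where
  open ≤-Reasoning
  reassoc : (U ++ Mid ++ Q) ++ S ≡ U ++ Mid ++ Q ++ S
  reassoc = trans (++-assoc U (Mid ++ Q) S) (cong (U ++_) (++-assoc Mid Q S))

module Exchange (m : ℕ) (n a : Fin m → ℕ) (d : ℕ) (a≤n : ∀ k → a k ≤ n k) where
  open Setup m n a d

  rowList : Sub → (k : Fin m) → List Bool
  rowList σ k = tabulate (σ k)

  cnt≡cntB : ∀ σ k → cnt σ k ≡ cntB (rowList σ k)
  cnt≡cntB σ k = cong cntB (map-allFin (σ k))

  deficit : Sub → Fin m → ℕ
  deficit σ k = a k ∸ cnt σ k

  filledRow : Sub → Fin m → List Bool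
  filledRow σ k = fillList (deficit σ k) (rowList σ k)

  trimmedRow : Sub → Fin m → List Bool
  trimmedRow σ k = trimList (deficit σ k) (rowList σ k)

  trimmedRows : Sub → List Bool
  trimmedRows σ = concatMap (trimmedRow σ) (allFin m)

  Bounded : Sub → Set
  Bounded σ = ∀ k → cnt σ k ≤ a k

  module Filled {σ F} (bnd : Bounded σ) (isF : IsFill σ F) where

    row-fill : ∀ k → row F k ≡ filledRow σ k
    row-fill k = trans (map-allFin (F k))
      (trans (tabulate-cong (revlexFirstFill-unique (n k) (a k) (σ k) (F k) (isF k)
                               (subst (_≤ a k) (cnt≡cntB σ k) (bnd k)) (a≤n k)))
        (trans (tabulate-fillFun (a k ∸ countTrue (σ k)) (σ k))
               (cong (λ z → fillList (a k ∸ z) (rowList σ k)) (sym (cnt≡cntB σ k)))))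

    cntB-filledRow : ∀ k → cntB (filledRow σ k) ≡ a k
    cntB-filledRow k = trans (cong cntB (sym (row-fill k))) (proj₁ (isF k))

    falses-filledRow : ∀ k → falses (filledRow σ k) ≤ n k ∸ a k
    falses-filledRow k = ≤-reflexive (trans (sym (m+n∸m≡n (cntB (filledRow σ k)) _))
      (cong₂ _∸_ (trans (cntB+falses (filledRow σ k))
                        (trans (length-fillList (deficit σ k) (rowList σ k)) (length-tabulate (σ k))))
                 (cntB-filledRow k)))

    deepTrues-filledRow+leadT : ∀ k → deepTrues 0 (filledRow σ k) 0 + leadT (filledRow σ k) ≡ a k
    deepTrues-filledRow+leadT k = trans (deepTrues-zero+leadT (filledRow σ k)) (cntB-filledRow k)

    deg-Φk+leadT : ∀ k → deg (Φk F k) + leadT (filledRow σ k) ≡ a k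
    deg-Φk+leadT k = trans (cong (λ z → sum (phiMon (n k ∸ a k) z) + leadT (filledRow σ k)) (row-fill k))
      (trans (cong (_+ leadT (filledRow σ k)) (sum-drop-phiMon-≡ 0 (n k ∸ a k) (filledRow σ k) (falses-filledRow k)))
             (deepTrues-filledRow+leadT k))

    trimmed≡trimmedRows : trimmed σ F ≡ trimmedRows σ
    trimmed≡trimmedRows = concatMap-cong (λ k → cong₂ take
      (trans (cong (_∸ deg (Φk F k)) (sym (deg-Φk+leadT k))) (m+n∸m≡n (deg (Φk F k)) (leadT (filledRow σ k))))
      (map-allFin (σ k))) (allFin m)

    μRestr≡ : ∀ i → μRestr σ F i ≡ phiMon c (trimmedRows σ) ++ phiMon (n i ∸ a i) (filledRow σ i)
    μRestr≡ i = cong₂ (λ x y → phiMon c x ++ phiMon (n i ∸ a i) y) trimmed≡trimmedRows (row-fill i)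

  sum-deficit : ∀ σ → Bounded σ → size σ ≡ d → sum (map (deficit σ) (allFin m)) ≡ c
  sum-deficit σ bnd sz = trans (sym (m+n∸n≡m _ d)) (cong (_∸ d)
    (trans (cong (sum (map (deficit σ) (allFin m)) +_) (sym sz))
      (trans (sym (sum-map-+ (deficit σ) (cnt σ) (allFin m))) (cong sum (map-cong (λ k → m∸n+n≡m (bnd k)) (allFin m))))))

  falses-trimmedRows : ∀ σ → Facet σ → falses (trimmedRows σ) ≤ c
  falses-trimmedRows σ (bnd , sz) = subst (falses (trimmedRows σ) ≤_) (sum-deficit σ bnd sz)
    (subst (_≤ sum (map (deficit σ) (allFin m))) (sym (falses-concatMap (trimmedRow σ) (allFin m)))
       (sum-map-mono (allFin m) (λ k → falses-trimList-≤ (deficit σ k) (rowList σ k))))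

  FilledRowBound : Sub → Sub → Fin m → Set
  FilledRowBound τ τ′ i = ∀ s → deepTrues 0 (filledRow τ′ i) s ≤ deepTrues 0 (filledRow τ i) s

  TrimmedRowsBound : Sub → Sub → Fin m → Set
  TrimmedRowsBound τ τ′ i = ∀ r →
    deepTrues 0 (trimmedRows τ′) r + leadT (filledRow τ i) ≤ deepTrues 0 (trimmedRows τ) r + leadT (filledRow τ′ i)

  ExchangeBounds : Sub → Sub → Fin m → Set
  ExchangeBounds τ τ′ i = Bounded τ′ × FilledRowBound τ τ′ i × TrimmedRowsBound τ τ′ i

  μRestr-suffixDominated : ∀ {τ τ′ F F′} i → Facet τ → IsFill τ F → IsFill τ′ F′ → ExchangeBounds τ τ′ i →
    length (μRestr τ′ F′ i) ≡ length (μRestr τ F i) × SuffixDominated (μRestr τ′ F′ i) (μRestr τ F i)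
  μRestr-suffixDominated {τ} {τ′} {F} {F′} i fac isF isF′ (bnd′ , hI , hII)
    rewrite Filled.μRestr≡ (proj₁ fac) isF i | Filled.μRestr≡ bnd′ isF′ i =
    length-phiMon-++ c L (trimmedRows τ) (trimmedRows τ′) (filledRow τ i) (filledRow τ′ i) ,
    suffixDominated-phiMon-++ c L (a i) (trimmedRows τ) (trimmedRows τ′) (filledRow τ i) (filledRow τ′ i)
      (falses-trimmedRows τ fac) (Filled.falses-filledRow (proj₁ fac) isF i)
      (Filled.deepTrues-filledRow+leadT (proj₁ fac) isF i) (Filled.deepTrues-filledRow+leadT bnd′ isF′ i)
      hI hII
    where L = n i ∸ a i

  by-block : ∀ {P : Fin m → Set} i → P i → (∀ k → k ≢ i → P k) → ∀ k → P k
  by-block i Pi Pk k with k ≟F i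
  ... | yes refl = Pi
  ... | no ne = Pk k ne

  pair-injective : ∀ {k} {x y : Fin (n k)} → _≡_ {A = El} (k , x) (k , y) → x ≡ y
  pair-injective refl = refl

  exchange-new : ∀ τ v w k j → (k , j) ≡ w → exchange τ v w k j ≡ true
  exchange-new τ v w k j e with (k , j) ≟El w
  ... | yes _ = refl
  ... | no ne = ⊥-elim (ne e)

  exchange-old : ∀ τ v w k j → (k , j) ≢ w → (k , j) ≡ v → exchange τ v w k j ≡ false
  exchange-old τ v w k j ne e with (k , j) ≟El w | (k , j) ≟El v
  ... | yes p | _ = ⊥-elim (ne p)
  ... | no _ | yes _ = refl
  ... | no _ | no ne′ = ⊥-elim (ne′ e)

  exchange-other : ∀ τ v w k j → (k , j) ≢ w → (k , j) ≢ v → exchange τ v w k j ≡ τ k j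
  exchange-other τ v w k j ne ne′ with (k , j) ≟El w | (k , j) ≟El v
  ... | yes p | _ = ⊥-elim (ne p)
  ... | no _ | yes p = ⊥-elim (ne′ p)
  ... | no _ | no _ = refl

  rowList-exchange-other : ∀ τ v w k → k ≢ proj₁ v → k ≢ proj₁ w → rowList (exchange τ v w) k ≡ rowList τ k
  rowList-exchange-other τ v w k nv nw =
    tabulate-cong (λ x → exchange-other τ v w k x (nw ∘ cong proj₁) (nv ∘ cong proj₁))

  cnt-cong : ∀ σ σ′ k → rowList σ′ k ≡ rowList σ k → cnt σ′ k ≡ cnt σ k
  cnt-cong σ σ′ k e = trans (cnt≡cntB σ′ k) (trans (cong cntB e) (sym (cnt≡cntB σ k)))

  trimmedRow-cong : ∀ σ σ′ k → rowList σ′ k ≡ rowList σ k → trimmedRow σ′ k ≡ trimmedRow σ k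
  trimmedRow-cong σ σ′ k e = cong₂ trimList (cong (a k ∸_) (cnt-cong σ σ′ k e)) e

  concatMap-trimmedRow-cong : ∀ σ σ′ {P : Fin m → Set} → (∀ k → P k → rowList σ′ k ≡ rowList σ k) →
    ∀ {L} → All P L → concatMap (trimmedRow σ′) L ≡ concatMap (trimmedRow σ) L
  concatMap-trimmedRow-cong σ σ′ same a = concatMap-congᴬ (All.map (λ {k} pk → trimmedRow-cong σ σ′ k (same k pk)) a)

  trimmedRows-split : ∀ σ σ′ i → (∀ k → k ≢ i → rowList σ′ k ≡ rowList σ k) →
    Σ (List Bool) λ P → Σ (List Bool) λ S →
      trimmedRows σ′ ≡ P ++ trimmedRow σ′ i ++ S × trimmedRows σ ≡ P ++ trimmedRow σ i ++ S
  trimmedRows-split σ σ′ i same with allFin-split i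
  ... | L₁ , L₂ , e , a₁ , a₂ =
    concatMap (trimmedRow σ) L₁ , concatMap (trimmedRow σ) L₂ ,
    trans (split σ′) (cong₂ (λ x y → x ++ trimmedRow σ′ i ++ y)
                            (concatMap-trimmedRow-cong σ σ′ same a₁) (concatMap-trimmedRow-cong σ σ′ same a₂)) ,
    split σ
    where
    split : ∀ ρ → trimmedRows ρ ≡ concatMap (trimmedRow ρ) L₁ ++ trimmedRow ρ i ++ concatMap (trimmedRow ρ) L₂
    split ρ = trans (cong (concatMap (trimmedRow ρ)) e) (concatMap-++ (trimmedRow ρ) L₁ (i ∷ L₂))

  trimmedRows-split₂ : ∀ σ σ′ k i → toℕ k < toℕ i → (∀ x → (x ≢ k × x ≢ i) → rowList σ′ x ≡ rowList σ x) →
    Σ (List Bool) λ P → Σ (List Bool) λ Mid → Σ (List Bool) λ S →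
      trimmedRows σ′ ≡ P ++ trimmedRow σ′ k ++ Mid ++ trimmedRow σ′ i ++ S ×
      trimmedRows σ ≡ P ++ trimmedRow σ k ++ Mid ++ trimmedRow σ i ++ S
  trimmedRows-split₂ σ σ′ k i k<i same with allFin-split₂ k i k<i
  ... | L₁ , L₂ , L₃ , e , a₁ , a₂ , a₃ =
    concatMap (trimmedRow σ) L₁ , concatMap (trimmedRow σ) L₂ , concatMap (trimmedRow σ) L₃ ,
    trans (split σ′) (cong₂ (λ x y → x ++ trimmedRow σ′ k ++ y) (concatMap-trimmedRow-cong σ σ′ same a₁)
      (cong₂ (λ x y → x ++ trimmedRow σ′ i ++ y) (concatMap-trimmedRow-cong σ σ′ same a₂) (concatMap-trimmedRow-cong σ σ′ same a₃))) ,
    split σ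
    where
    split : ∀ ρ → trimmedRows ρ ≡ concatMap (trimmedRow ρ) L₁ ++ trimmedRow ρ k ++ concatMap (trimmedRow ρ) L₂
                                     ++ trimmedRow ρ i ++ concatMap (trimmedRow ρ) L₃
    split ρ = trans (cong (concatMap (trimmedRow ρ)) e) (concatMap-split₂ (trimmedRow ρ) L₁ k L₂ i L₃)

  rows-exchange-sameBlock : ∀ τ i (j p : Fin (n i)) → τ i j ≡ true → τ i p ≡ false → toℕ p < toℕ j →
    Σ (List Bool) λ A → Σ (List Bool) λ B → Σ (List Bool) λ C →
      rowList τ i ≡ A ++ false ∷ B ++ true ∷ C ×
      rowList (exchange τ (i , j) (i , p)) i ≡ A ++ true ∷ B ++ false ∷ C ×
      ((∀ x → toℕ x < toℕ p → τ i x ≡ true) → All (_≡ true) A)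
  rows-exchange-sameBlock τ i j p τj τp p<j with tabulate-split₂ (τ i) p j p<j
  ... | A , B , C , tabulate≡ , prefix = A , B , C , rowτ , rowτ′ , prefix
    where
    v w : El
    v = (i , j)
    w = (i , p)
    j≢p : j ≢ p
    j≢p eq = <-irrefl (cong toℕ (sym eq)) p<j
    rowτ : rowList τ i ≡ A ++ false ∷ B ++ true ∷ C
    rowτ = trans (tabulate≡ (τ i) (λ _ _ _ → refl)) (cong₂ (λ x y → A ++ x ∷ B ++ y ∷ C) τp τj)
    rowτ′ : rowList (exchange τ v w) i ≡ A ++ true ∷ B ++ false ∷ C
    rowτ′ = trans (tabulate≡ (exchange τ v w i) (λ x ne₁ ne₂ → exchange-other τ v w i x (ne₁ ∘ pair-injective) (ne₂ ∘ pair-injective)))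
      (cong₂ (λ x y → A ++ x ∷ B ++ y ∷ C) (exchange-new τ v w i p refl) (exchange-old τ v w i j (j≢p ∘ pair-injective) refl))

  -- The case v ∈ up(τ), or v ∈ tail(τ) with Gap(τ) ∈ V_i.
  exchange-sameBlock : ∀ τ i (j p : Fin (n i)) → Bounded τ → τ i j ≡ true → τ i p ≡ false →
    (∀ x → toℕ x < toℕ p → τ i x ≡ true) → toℕ p < toℕ j → ExchangeBounds τ (exchange τ (i , j) (i , p)) i
  exchange-sameBlock τ i j p bnd τj τp τ<p p<j with rows-exchange-sameBlock τ i j p τj τp p<j
  ... | A , B , C , rowτ , rowτ′ , prefix = bounded , rowBound , trimBound
    where
    τ′ = exchange τ (i , j) (i , p)
    e = deficit τ i
    others : ∀ k → k ≢ i → rowList τ′ k ≡ rowList τ k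
    others k ne = rowList-exchange-other τ (i , j) (i , p) k ne ne
    cnt-i : cnt τ′ i ≡ cnt τ i
    cnt-i = trans (cnt≡cntB τ′ i) (trans (cong cntB rowτ′)
              (trans (cntB-advanceTrue A B C) (trans (cong cntB (sym rowτ)) (sym (cnt≡cntB τ i)))))
    bounded : Bounded τ′
    bounded = by-block i (subst (_≤ a i) (sym cnt-i) (bnd i))
                         (λ k ne → subst (_≤ a k) (sym (cnt-cong τ τ′ k (others k ne))) (bnd k))
    deficit′ : deficit τ′ i ≡ e
    deficit′ = cong (a i ∸_) cnt-i
    rowBound : FilledRowBound τ τ′ i
    rowBound = subst₂ (λ F G → ∀ s → deepTrues 0 F s ≤ deepTrues 0 G s)
      (sym (cong₂ fillList deficit′ rowτ′)) (sym (cong (fillList e) rowτ))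
      (deepTrues-fillList-advance A B C e (prefix τ<p) 0)
    trimBound : TrimmedRowsBound τ τ′ i
    trimBound r with trimmedRows-split τ τ′ i others
    ... | P , S , eτ′ , eτ
      rewrite eτ′ | eτ | cong (trimList e) rowτ | cong₂ trimList deficit′ rowτ′
            | cong (fillList e) rowτ | cong₂ fillList deficit′ rowτ′ =
      deepTrues-replaceMiddle P _ _ S _ _ (deepTrues-trimList-advance A B C e (prefix τ<p))
        (falses-trimList-advance A B C e (prefix τ<p)) r

  cnt-set : ∀ σ σ′ k {X Y} → rowList σ k ≡ X ++ false ∷ Y → rowList σ′ k ≡ X ++ true ∷ Y → cnt σ′ k ≡ suc (cnt σ k)
  cnt-set σ σ′ k {X} {Y} row row′ = trans (cnt≡cntB σ′ k) (trans (cong cntB row′)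
    (trans (cntB-unset X Y) (cong suc (trans (cong cntB (sym row)) (sym (cnt≡cntB σ k))))))

  deficit-set : ∀ σ σ′ k → cnt σ k < a k → cnt σ′ k ≡ suc (cnt σ k) → deficit σ k ≡ suc (deficit σ′ k)
  deficit-set σ σ′ k notFull cnt′ = trans (∸-≡-suc (a k) (cnt σ k) notFull) (cong (λ z → suc (a k ∸ z)) (sym cnt′))

  rows-exchange-earlierBlock : ∀ τ (i : Fin m) (j : Fin (n i)) (k : Fin m) (p : Fin (n k)) → k ≢ i →
    τ i j ≡ true → τ k p ≡ false →
    Σ (List Bool) λ X → Σ (List Bool) λ Y → Σ (List Bool) λ A → Σ (List Bool) λ B →
      rowList τ k ≡ X ++ false ∷ Y × rowList (exchange τ (i , j) (k , p)) k ≡ X ++ true ∷ Y ×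
      rowList τ i ≡ A ++ true ∷ B × rowList (exchange τ (i , j) (k , p)) i ≡ A ++ false ∷ B ×
      ((∀ x → toℕ x < toℕ p → τ k x ≡ true) → All (_≡ true) X)
  rows-exchange-earlierBlock τ i j k p k≢i τj τp with tabulate-split (τ k) p | tabulate-split (τ i) j
  ... | X , Y , tabulateK≡ , prefixK | A , B , tabulateI≡ , _ = X , Y , A , B , rowK , rowK′ , rowI , rowI′ , prefixK
    where
    v w : El
    v = (i , j)
    w = (k , p)
    rowK : rowList τ k ≡ X ++ false ∷ Y
    rowK = trans (tabulateK≡ (τ k) (λ _ _ → refl)) (cong (λ z → X ++ z ∷ Y) τp)
    rowK′ : rowList (exchange τ v w) k ≡ X ++ true ∷ Y
    rowK′ = trans (tabulateK≡ (exchange τ v w k) (λ x ne → exchange-other τ v w k x (ne ∘ pair-injective) (k≢i ∘ cong proj₁)))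
      (cong (λ z → X ++ z ∷ Y) (exchange-new τ v w k p refl))
    rowI : rowList τ i ≡ A ++ true ∷ B
    rowI = trans (tabulateI≡ (τ i) (λ _ _ → refl)) (cong (λ z → A ++ z ∷ B) τj)
    rowI′ : rowList (exchange τ v w) i ≡ A ++ false ∷ B
    rowI′ = trans (tabulateI≡ (exchange τ v w i) (λ x ne → exchange-other τ v w i x (k≢i ∘ sym ∘ cong proj₁) (ne ∘ pair-injective)))
      (cong (λ z → A ++ z ∷ B) (exchange-old τ v w i j (k≢i ∘ sym ∘ cong proj₁) refl))

  -- The case v ∈ tail(τ) with Gap(τ) in an earlier block.
  exchange-earlierBlock : ∀ τ (i : Fin m) (j : Fin (n i)) (k : Fin m) (p : Fin (n k)) → Bounded τ →
    τ i j ≡ true → τ k p ≡ false → (∀ x → toℕ x < toℕ p → τ k x ≡ true) → cnt τ k < a k →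
    toℕ k < toℕ i → ExchangeBounds τ (exchange τ (i , j) (k , p)) i
  exchange-earlierBlock τ i j k p bnd τj τp τ<p notFull k<i
    with rows-exchange-earlierBlock τ i j k p (λ eq → <-irrefl (cong toℕ eq) k<i) τj τp
  ... | X , Y , A , B , rowK , rowK′ , rowI , rowI′ , prefixK = bounded , rowBound , trimBound
    where
    τ′ = exchange τ (i , j) (k , p)
    others : ∀ x → (x ≢ k × x ≢ i) → rowList τ′ x ≡ rowList τ x
    others x (ne₁ , ne₂) = rowList-exchange-other τ (i , j) (k , p) x ne₂ ne₁
    cntK : cnt τ′ k ≡ suc (cnt τ k)
    cntK = cnt-set τ τ′ k rowK rowK′
    cntI : cnt τ i ≡ suc (cnt τ′ i)
    cntI = cnt-set τ′ τ i rowI′ rowI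
    bounded : Bounded τ′
    bounded = by-block k (subst (_≤ a k) (sym cntK) notFull)
      (λ x → by-block {P = λ z → z ≢ k → cnt τ′ z ≤ a z} i (λ _ → ≤-trans (n≤1+n _) (subst (_≤ a i) cntI (bnd i)))
        (λ y y≢i y≢k → subst (_≤ a y) (sym (cnt-cong τ τ′ y (others y (y≢k , y≢i)))) (bnd y)) x)
    e₀ = deficit τ′ k
    e = deficit τ i
    deficitK : deficit τ k ≡ suc e₀
    deficitK = deficit-set τ τ′ k notFull cntK
    deficitI′ : deficit τ′ i ≡ suc e
    deficitI′ = deficit-set τ′ τ i (subst (_≤ a i) cntI (bnd i)) cntI
    rowBound : FilledRowBound τ τ′ i
    rowBound = subst₂ (λ F G → ∀ s → deepTrues 0 F s ≤ deepTrues 0 G s)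
      (sym (cong₂ fillList deficitI′ rowI′)) (sym (cong (fillList e) rowI))
      (λ s → deepTrues-fillList-unset A B e 0 s)
    trimK : trimmedRow τ k ≡ X ++ false ∷ trimList e₀ Y
    trimK = trans (cong₂ trimList deficitK rowK) (proj₁ (proj₂ (fillList-truePrefix X Y e₀ (prefixK τ<p))))
    trimK′ : trimmedRow τ′ k ≡ X ++ true ∷ trimList e₀ Y
    trimK′ = trans (cong (trimList e₀) rowK′) (proj₂ (proj₂ (fillList-truePrefix X Y e₀ (prefixK τ<p))))
    trimBound : TrimmedRowsBound τ τ′ i
    trimBound r with trimmedRows-split₂ τ τ′ k i k<i others
    ... | P , Mid , S , eτ′ , eτ
      rewrite eτ′ | eτ | trimK | trimK′ | cong (trimList e) rowI | cong₂ trimList deficitI′ rowI′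
            | cong (fillList e) rowI | cong₂ fillList deficitI′ rowI′ =
      deepTrues-crossRows P X (trimList e₀ Y) Mid S _ _ _ _ (trimList-unset A B e) r

  offsetTerm : Fin m → Fin m → ℕ
  offsetTerm k x = if toℕ x <ᵇ toℕ k then n x else 0

  offsetTerm-mono : ∀ {k i} → toℕ k < toℕ i → ∀ x → offsetTerm k x ≤ offsetTerm i x
  offsetTerm-mono {k} {i} k<i x with toℕ x <ᵇ toℕ k in eq
  ... | true rewrite <ᵇ-true (<-trans (<ᵇ-sound (toℕ x) (toℕ k) eq) k<i) = ≤-refl
  ... | false = z≤n

  offsetTerm-self : ∀ k → offsetTerm k k ≡ 0
  offsetTerm-self k rewrite <ᵇ-irrefl (toℕ k) = refl

  offsetTerm-earlier : ∀ {k i} → toℕ k < toℕ i → offsetTerm i k ≡ n k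
  offsetTerm-earlier k<i rewrite <ᵇ-true k<i = refl

  offset-< : ∀ {k i} → toℕ k < toℕ i → offset k + n k ≤ offset i
  offset-< {k} {i} k<i with allFin-split k
  ... | L₁ , L₂ , e , _ , _ = begin
    offset k + n k                                   ≡⟨ cong (_+ n k) (split k) ⟩
    S₁ + (offsetTerm k k + S₂) + n k                  ≡⟨ cong (λ z → S₁ + (z + S₂) + n k) (offsetTerm-self k) ⟩
    S₁ + S₂ + n k                                    ≡⟨ solve 3 (λ x y z → x :+ y :+ z := x :+ (z :+ y)) refl S₁ S₂ (n k) ⟩
    S₁ + (n k + S₂)                                  ≤⟨ +-mono-≤ (sum-map-mono L₁ (offsetTerm-mono k<i))
                                                         (+-monoʳ-≤ (n k) (sum-map-mono L₂ (offsetTerm-mono k<i))) ⟩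
    T₁ + (n k + T₂)                                  ≡⟨ cong (λ z → T₁ + (z + T₂)) (sym (offsetTerm-earlier k<i)) ⟩
    T₁ + (offsetTerm i k + T₂)                        ≡⟨ sym (split i) ⟩
    offset i                                         ∎
    where
    open ≤-Reasoning
    split : ∀ x → offset x ≡ sum (map (offsetTerm x) L₁) + (offsetTerm x k + sum (map (offsetTerm x) L₂))
    split x = trans (cong (λ z → sum (map (offsetTerm x) z)) e) (sum-map-++ (offsetTerm x) L₁ (k ∷ L₂))
    S₁ = sum (map (offsetTerm k) L₁)
    S₂ = sum (map (offsetTerm k) L₂)
    T₁ = sum (map (offsetTerm i) L₁)
    T₂ = sum (map (offsetTerm i) L₂)

  pos-<-blocks : ∀ {k i} → toℕ k < toℕ i → ∀ (x : Fin (n k)) (y : Fin (n i)) → pos (k , x) < pos (i , y)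
  pos-<-blocks {k} {i} k<i x y = <-≤-trans (+-monoʳ-< (offset k) (Fin.toℕ<n x))
    (≤-trans (offset-< k<i) (m≤m+n (offset i) (toℕ y)))

  pos-≤-sameBlock : ∀ i (x y : Fin (n i)) → pos (i , x) ≤ pos (i , y) → toℕ x ≤ toℕ y
  pos-≤-sameBlock i x y = +-cancelˡ-≤ (offset i) (toℕ x) (toℕ y)

  pos-<-sameBlock : ∀ i (x y : Fin (n i)) → pos (i , x) < pos (i , y) → toℕ x < toℕ y
  pos-<-sameBlock i x y lt = +-cancelˡ-< (offset i) (toℕ x) (toℕ y) lt

  pos-<⇒block-< : ∀ (x y : El) → pos x < pos y → proj₁ x ≢ proj₁ y → toℕ (proj₁ x) < toℕ (proj₁ y)
  pos-<⇒block-< (k , x) (i , y) lt ne with <-cmp (toℕ k) (toℕ i)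
  ... | tri< p _ _ = p
  ... | tri≈ _ p _ = ⊥-elim (ne (toℕ-injective p))
  ... | tri> _ _ p = ⊥-elim (<-asym lt (pos-<-blocks p y x))

  pos-≤⇒< : ∀ (x y : El) → pos x ≤ pos y → proj₁ x ≢ proj₁ y → pos x < pos y
  pos-≤⇒< (k , x) (i , y) le ne with <-cmp (toℕ k) (toℕ i)
  ... | tri< p _ _ = pos-<-blocks p x y
  ... | tri≈ _ p _ = ⊥-elim (ne (toℕ-injective p))
  ... | tri> _ _ p = ⊥-elim (<⇒≱ (pos-<-blocks p y x) le)

  prefix-of-minimal : ∀ τ k (p : Fin (n k)) → (∀ x → (k , x) ∉ₛ τ → pos (k , p) ≤ pos (k , x)) →
    ∀ x → toℕ x < toℕ p → τ k x ≡ true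
  prefix-of-minimal τ k p pMin x x<p with τ k x in eq
  ... | true = refl
  ... | false = ⊥-elim (<⇒≱ x<p (pos-≤-sameBlock k p x (pMin x (λ x∈τ → contradiction (trans (sym eq) x∈τ) λ ()))))

  size-< : ∀ σ τ → (∀ k → cnt σ k ≤ cnt τ k) → ∀ i → cnt σ i < cnt τ i → size σ < size τ
  size-< σ τ h i lt with allFin-split i
  ... | L₁ , L₂ , e , _ , _ = subst₂ _<_ (sym (split σ)) (sym (split τ))
          (+-mono-≤-< (sum-map-mono L₁ h) (+-mono-<-≤ lt (sum-map-mono L₂ h)))
    where
    split : ∀ ρ → size ρ ≡ sum (map (cnt ρ) L₁) + sum (map (cnt ρ) (i ∷ L₂))
    split ρ = trans (cong (λ z → sum (map (cnt ρ) z)) e) (sum-map-++ (cnt ρ) L₁ (i ∷ L₂))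

  cnt-⊆ : ∀ σ τ k → (∀ x → σ k x ≡ true → τ k x ≡ true) → cnt σ k ≤ cnt τ k
  cnt-⊆ σ τ k sub = subst₂ _≤_ (sym (cnt≡cntB σ k)) (sym (cnt≡cntB τ k)) (countTrue-mono (σ k) (τ k) sub)

  cnt-⊂ : ∀ σ τ k → (∀ x → σ k x ≡ true → τ k x ≡ true) → ∀ x → σ k x ≡ false → τ k x ≡ true → cnt σ k < cnt τ k
  cnt-⊂ σ τ k sub x σx τx =
    subst₂ _<_ (sym (cnt≡cntB σ k)) (sym (cnt≡cntB τ k)) (countTrue-strict (σ k) (τ k) sub x σx τx)

  minimalPosition : (P : El → Set) → (∀ x → Dec (P x)) → ∀ x → P x →
    Σ El λ g → P g × (∀ y → P y → pos g ≤ pos y)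
  minimalPosition P P? x px = go (suc (pos x)) x px ≤-refl
    where
    go : ∀ b x → P x → pos x < b → Σ El λ g → P g × (∀ y → P y → pos g ≤ pos y)
    go (suc b) x px (s≤s lt) with any? (λ k → any? (λ j → P? (k , j) ×-dec (pos (k , j) <? pos x)))
    ... | yes (k , j , py , lty) = go b (k , j) py (<-≤-trans lty lt)
    ... | no none = x , px , λ y py → ≮⇒≥ (λ lty → none (proj₁ y , proj₂ y , py , lty))

  GapCandidate : Sub → El → Set
  GapCandidate τ x = x ∉ₛ τ × ¬ FL τ (proj₁ x)

  gapCandidate? : ∀ τ x → Dec (GapCandidate τ x)
  gapCandidate? τ x = ¬? (τ (proj₁ x) (proj₂ x) Bool.≟ true) ×-dec ¬? (cnt τ (proj₁ x) ≟ a (proj₁ x))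

  gap? : ∀ τ → Σ El (IsGap τ) ⊎ (∀ x → ¬ GapCandidate τ x)
  gap? τ with any? (λ k → any? (λ j → gapCandidate? τ (k , j)))
  ... | no none = inj₂ (λ x cx → none (proj₁ x , proj₂ x , cx))
  ... | yes (k , j , c) with minimalPosition (GapCandidate τ) (gapCandidate? τ) (k , j) c
  ...   | g , (g∉τ , ¬full) , gMin = inj₁ (g , g∉τ , ¬full , λ x x∉τ x¬full → gMin x (x∉τ , x¬full))

  tail? : ∀ τ v → v ∈ₛ τ → Dec (Tail τ v)
  tail? τ v v∈τ with gap? τ
  ... | inj₂ none = no λ { (_ , g , (g∉τ , ¬full , _) , _) → none g (g∉τ , ¬full) }
  ... | inj₁ (g , isGap) with pos g <? pos v
  ...   | yes lt = yes (v∈τ , g , isGap , lt)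
  ...   | no ¬lt = no λ { (_ , g′ , (g′∉τ , ¬full′ , _) , lt′) → ¬lt (≤-<-trans (proj₂ (proj₂ isGap) g′ g′∉τ ¬full′) lt′) }

  -- In σ ≻ τ with τ - {v} ⊆ σ the revlex witness can only be v; since |σ| = |τ|,
  -- σ then has a new element, and it precedes v.
  RLex-newElement : ∀ τ v → Facet τ → RLex τ v →
    Σ Sub λ σ → Bounded σ × (∀ x → x ∈ₛ τ → x ≢ v → x ∈ₛ σ) ×
      Σ El λ x → x ∈ₛ σ × x ∉ₛ τ × pos x ≤ pos v
  RLex-newElement τ v (_ , sz) (v∈τ , σ , (bndσ , szσ) , (u , u∈τ , u∉σ , uMax) , τ-v⊆σ) with u ≟El v
  ... | no u≢v = contradiction (trans (sym (τ-v⊆σ u u∈τ u≢v)) u∉σ) λ ()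
  ... | yes refl with any? (λ k → any? (λ x → (σ k x Bool.≟ true) ×-dec (τ k x Bool.≟ false)))
  ...   | yes (k , x , σx , τx) =
    σ , bndσ , τ-v⊆σ , (k , x) , σx , (λ x∈τ → contradiction (trans (sym x∈τ) τx) λ ()) ,
    uMax (k , x) (λ eq → contradiction (trans (sym σx) (trans eq τx)) λ ())
  ...   | no none = ⊥-elim (<-irrefl (trans szσ (sym sz)) (size-< σ τ (λ k → cnt-⊆ σ τ k (σ⊆τ k)) (proj₁ u) σ<τ))
    where
    σ⊆τ : ∀ k x → σ k x ≡ true → τ k x ≡ true
    σ⊆τ k x σx = Bool.¬-not (λ τx → none (k , x , σx , τx))
    σ<τ : cnt σ (proj₁ u) < cnt τ (proj₁ u)
    σ<τ = cnt-⊂ σ τ (proj₁ u) (σ⊆τ (proj₁ u)) (proj₂ u) u∉σ u∈τ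

  newElement⇒notFull : ∀ τ σ v x → Bounded σ → (∀ y → y ∈ₛ τ → y ≢ v → y ∈ₛ σ) →
    x ∈ₛ σ → x ∉ₛ τ → proj₁ x ≢ proj₁ v → ¬ FL τ (proj₁ x)
  newElement⇒notFull τ σ v (k , x) bndσ τ-v⊆σ x∈σ x∉τ k≢ full = <-irrefl full (<-≤-trans
    (cnt-⊂ τ σ k (λ y τy → τ-v⊆σ (k , y) τy (k≢ ∘ cong proj₁)) x (Bool.¬-not x∉τ) x∈σ) (bndσ k))

  candidate⇒Tail : ∀ τ v x → v ∈ₛ τ → GapCandidate τ x → pos x < pos v → Tail τ v
  candidate⇒Tail τ v x v∈τ cx x<v with gap? τ
  ... | inj₂ none = ⊥-elim (none x cx)
  ... | inj₁ (g , isGap@(_ , _ , gMin)) = v∈τ , g , isGap , ≤-<-trans (gMin x (proj₁ cx) (proj₂ cx)) x<v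

  fgap<up : ∀ τ i (j p : Fin (n i)) → Facet τ → RLex τ (i , j) → ¬ Tail τ (i , j) →
    (∀ x → proj₁ x ≡ i → x ∉ₛ τ → pos (i , p) ≤ pos x) → toℕ p < toℕ j
  fgap<up τ i j p fac rl ¬tail pMin with RLex-newElement τ (i , j) fac rl
  ... | σ , bndσ , τ-v⊆σ , (k , x) , x∈σ , x∉τ , x≤v with k ≟F i
  ...   | no k≢i = ⊥-elim (¬tail (candidate⇒Tail τ (i , j) (k , x) (proj₁ rl)
                     (x∉τ , newElement⇒notFull τ σ (i , j) (k , x) bndσ τ-v⊆σ x∈σ x∉τ k≢i) (pos-≤⇒< (k , x) (i , j) x≤v k≢i)))
  ...   | yes refl = ≤-<-trans (pos-≤-sameBlock i p x (pMin (i , x) refl x∉τ))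
                       (≤∧≢⇒< (pos-≤-sameBlock i x j x≤v) (λ eq → x∉τ (subst (λ z → τ i z ≡ true) (sym (toℕ-injective eq)) (proj₁ rl))))

  exchange-tail : ∀ τ i (j : Fin (n i)) (w : El) → Bounded τ → τ i j ≡ true →
    IsGap τ w → pos w < pos (i , j) → ExchangeBounds τ (exchange τ (i , j) w) i
  exchange-tail τ i j (k , p) bnd τj (p∉τ , ¬full , pMin) w<v with k ≟F i
  ... | yes refl = exchange-sameBlock τ i j p bnd τj (Bool.¬-not p∉τ) prefix (pos-<-sameBlock i p j w<v)
    where
    prefix : ∀ x → toℕ x < toℕ p → τ i x ≡ true
    prefix = prefix-of-minimal τ i p (λ x x∉τ → pMin (i , x) x∉τ ¬full)
  ... | no k≢i = exchange-earlierBlock τ i j k p bnd τj (Bool.¬-not p∉τ) prefix (≤∧≢⇒< (bnd k) ¬full)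
                   (pos-<⇒block-< (k , p) (i , j) w<v k≢i)
    where
    prefix : ∀ x → toℕ x < toℕ p → τ k x ≡ true
    prefix = prefix-of-minimal τ k p (λ x x∉τ → pMin (k , x) x∉τ ¬full)

  exchange-up : ∀ τ i (j : Fin (n i)) (w : El) → Facet τ → RLex τ (i , j) → ¬ Tail τ (i , j) →
    IsFgap τ i w → ExchangeBounds τ (exchange τ (i , j) w) i
  exchange-up τ i j (.i , p) fac rl ¬tail (refl , _ , p∉τ , pMin) =
    exchange-sameBlock τ i j p (proj₁ fac) (proj₁ rl) (Bool.¬-not p∉τ)
      (prefix-of-minimal τ i p (λ x → pMin (i , x) refl)) (fgap<up τ i j p fac rl ¬tail pMin)

  exchange-bounds : ∀ τ i (j : Fin (n i)) → Facet τ → RLex τ (i , j) → (w : El) →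
    (Tail τ (i , j) → IsGap τ w) → (¬ Tail τ (i , j) → IsFgap τ i w) → ExchangeBounds τ (exchange τ (i , j) w) i
  exchange-bounds τ i j fac rl w isGap isFgap with tail? τ (i , j) (proj₁ rl)
  ... | yes tail@(_ , g , (g∉τ , ¬full , _) , g<v) =
    exchange-tail τ i j w (proj₁ fac) (proj₁ rl) (isGap tail) (≤-<-trans (proj₂ (proj₂ (isGap tail)) g g∉τ ¬full) g<v)
  ... | no ¬tail = exchange-up τ i j w fac rl ¬tail (isFgap ¬tail)

corollary6p9 : (m : ℕ) (n a : Fin m → ℕ) (d : ℕ) →
    (∀ k → a k ≤ n k) → 1 ≤ d → d ≤ Σa m a →
    let open Setup m n a d in
    (τ γ : Sub) → Facet τ → γ ⊂ₛ τ →
    Σ El (λ u → RLex τ u × u ∉ₛ γ) →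
    (i : Fin m) (j : Fin (n i)) →
    RLex τ (i , j) → (i , j) ∉ₛ γ →
    (w : El) →
    (Tail τ (i , j) → IsGap τ w) →
    (¬ Tail τ (i , j) → IsFgap τ i w) →
    (F F′ : Fill) → IsFill τ F → IsFill (exchange τ (i , j) w) F′ →
    deg (μRestr (exchange τ (i , j) w) F′ i) ≤ deg (μRestr τ F i)
    × Σ (List ℕ) (λ ν → Divides ν (μRestr τ F i)
        × deg ν ≡ deg (μRestr (exchange τ (i , j) w) F′ i)
        × μRestr (exchange τ (i , j) w) F′ i ⪰ᵐ ν)
corollary6p9 m n a d a≤n _ _ τ _ fac _ _ i j rl _ w isGap isFgap F F′ isF isF′ =
  let (sameLength , dominated) = μRestr-suffixDominated i fac isF isF′ (exchange-bounds τ i j fac rl w isGap isFgap)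
  in suffixDominated⇒divisor _ _ sameLength dominated
  where open Exchange m n a d a≤n
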